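{- The Klein cubic graph $\Gamma'$ is both a $\{C_7\}_{P_2}$-UH graph and a $\{\vec{C}_7\}_{\vec{P}_2}$-UH digraph. Moreover, $\Gamma'$ has exactly $24$ (oriented) $7$-cycles. Filling each of these cycles with a $2$-cell yields an embedding of $\Gamma'$ in the closed orientable surface $T_3$ of genus $3$, and this embedding is the Klein map of type $\{7,3\}_8$.
   Context: The Klein cubic graph $\Gamma'$ is the $56$-vertex, $84$-edge cubic graph of girth $7$ that forms the $1$-skeleton of the Klein map. The Klein map is the regular map of type $\{7,3\}_8$: it has heptagonal faces, three faces at each vertex, and Petrie polygons of length $8$, and it lies on the orientable surface of genus $3$. $P_k$ denotes the path with $k$ vertices ($P_2$ is an edge) and $C_7$ the $7$-cycle. A graph is regarded as a digraph by replacing each edge by two oppositely oriented arcs. $\vec{C}_7$ is the oriented $7$-cycle and $\vec{P}_2$ a single arc. A (di)graph $G$ is $X$-UH if every isomorphism between two induced copies of $X$ in $G$ extends to an automorphism of $G$. For a subgraph $M$ of a graph $H$, $G$ is a $\{H\}_M$-UH graph if all of the following hold: - $G$ is $M$-UH and $H$-UH; - for every copy $H_0$ of $H$ in $G$ and every copy $M_0$ of $M$ in $H_0$, there is exactly one copy $H_1\neq H_0$ of $H$ in $G$ with $H_0\cap H_1=M_0$ (equal vertex sets and edge sets). For digraphs, $G$ is a $\{\vec{H}\}_{\vec{M}}$-UH digraph if all of the following hold: - $G$ is $\vec{M}$-UH and $\vec{H}$-UH; - for every copy $\vec{H}_0$ of $\vec{H}$ and every copy $\vec{M}_0$ of $\vec{M}$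 in $\vec{H}_0$, there is exactly one copy $\vec{H}_1\neq\vec{H}_0$ with $V(\vec{H}_0)\cap V(\vec{H}_1)=V(\vec{M}_0)$ and $A(\vec{H}_0)\cap\bar{A}(\vec{H}_1)=A(\vec{M}_0)$. Here $\bar{A}(\vec{H}_1)$ is the set of arcs of $\vec{H}_1$ with reversed orientation. -}

module Defs where

open import Data.Nat using (ℕ; zero; suc; _+_; _*_; _<_; _%_; _≤ᵇ_; _≡ᵇ_)
open import Data.Fin using (Fin; toℕ)
open import Data.Bool using (Bool; true; false; _∨_; _∧_)
open import Data.Product using (Σ; ∃; ∃₂; _×_; _,_; proj₁; proj₂)
open import Data.List using (List; []; _∷_; length; filterᵇ; cartesianProduct; allFin; upTo)
open import Data.Bool.ListAction using (all; any)
open import Data.Vec using (Vec; lookup) renaming ([] to []ᵥ; _∷_ to _∷ᵥ_)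
open import Relation.Binary.PropositionalEquality using (_≡_; _≢_)
open import Relation.Nullary using (¬_)

_iff_ : Set → Set → Set
A iff B = (A → B) × (B → A)

iter : {A : Set} → (A → A) → ℕ → A → A
iter f zero    x = x
iter f (suc k) x = f (iter f k x)

-- A (simple) graph is regarded,
-- as in the paper, as the digraph obtained by replacing each edge by two
-- oppositely oriented arcs (i.e. a symmetric, loopless arc relation).

record Digraph (n : ℕ) : Set where
  field
    arc : Fin n → Fin n → Bool

open Digraph public

Arc : {n : ℕ} → Digraph n → Fin n → Fin n → Set
Arc G u v = arc G u v ≡ true

-- A copy of H in G: a subdigraph of G isomorphic to H, presented by an
-- injective arc-preserving map  emb : V(H) → V(G)  (the copy is the image:
-- vertex set  emb(V(H))  and arc set  emb(A(H)) ).
record Copy {k n : ℕ} (H : Digraph k) (G : Digraph n) : Set where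
  field
    emb     : Fin k → Fin n
    emb-inj : ∀ i j → emb i ≡ emb j → i ≡ j
    emb-arc : ∀ i j → Arc H i j → Arc G (emb i) (emb j)

open Copy public

module _ {k n : ℕ} {H : Digraph k} {G : Digraph n} where

  _∈V_ : Fin n → Copy H G → Set
  v ∈V c = ∃ λ i → emb c i ≡ v

  -- arc set of a copy (for graphs: the edge set, each edge as both arcs)
  _∈A_ : Fin n × Fin n → Copy H G → Set
  (u , v) ∈A c = ∃₂ λ i j → Arc H i j × emb c i ≡ u × emb c j ≡ v

  Induced : Copy H G → Set
  Induced c = ∀ i j → Arc G (emb c i) (emb c j) → Arc H i j

  SameCopy : Copy H G → Copy H G → Set
  SameCopy c d = (∀ v → (v ∈V c) iff (v ∈V d))
               × (∀ u v → ((u , v) ∈A c) iff ((u , v) ∈A d))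

_⊑_ : {k l n : ℕ} {M : Digraph k} {H : Digraph l} {G : Digraph n}
    → Copy M G → Copy H G → Set
_⊑_ {n = n} m h = (∀ (v : Fin n) → v ∈V m → v ∈V h)
                × (∀ (u v : Fin n) → (u , v) ∈A m → (u , v) ∈A h)

record Aut {n : ℕ} (G : Digraph n) : Set where
  field
    to       : Fin n → Fin n
    from     : Fin n → Fin n
    to-from  : ∀ v → to (from v) ≡ v
    from-to  : ∀ v → from (to v) ≡ v
    arc-pres : ∀ u v → arc G u v ≡ arc G (to u) (to v)

open Aut public

-- An isomorphism between two copies c, d of H in G (as subdigraphs):
-- a bijection V(c) → V(d) (given by a function on Fin n, only its values
-- on V(c) matter) mapping the arcs of c exactly onto the arcs of d.
record CopyIso {k n : ℕ} {H : Digraph k} {G : Digraph n}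
               (c d : Copy H G) : Set where
  field
    map   : Fin n → Fin n
    into  : ∀ v → v ∈V c → map v ∈V d
    onto  : ∀ w → w ∈V d → ∃ λ v → (v ∈V c) × (map v ≡ w)
    inj   : ∀ u v → u ∈V c → v ∈V c → map u ≡ map v → u ≡ v
    arcs  : ∀ u v → u ∈V c → v ∈V c
          → ((u , v) ∈A c) iff ((map u , map v) ∈A d)

open CopyIso public

Extends : {k n : ℕ} {H : Digraph k} {G : Digraph n} {c d : Copy H G}
        → CopyIso c d → Set
Extends {G = G} {c = c} φ = Σ (Aut G) λ σ → ∀ v → v ∈V c → to σ v ≡ map φ v

UH : {k n : ℕ} → Digraph k → Digraph n → Set
UH X G = ∀ (c d : Copy X G) → Induced c → Induced d
       → (φ : CopyIso c d) → Extends φ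

DiUH : {k n : ℕ} → Digraph k → Digraph n → Set
DiUH X G = ∀ (c d : Copy X G) → (φ : CopyIso c d) → Extends φ

module _ {k l n : ℕ} {H : Digraph k} {M : Digraph l} {G : Digraph n} where

  GlueG : Copy H G → Copy H G → Copy M G → Set
  GlueG h₀ h₁ m₀ = ¬ SameCopy h₁ h₀
                 × (∀ v → ((v ∈V h₀) × (v ∈V h₁)) iff (v ∈V m₀))
                 × (∀ u v → (((u , v) ∈A h₀) × ((u , v) ∈A h₁)) iff ((u , v) ∈A m₀))

  GlueD : Copy H G → Copy H G → Copy M G → Set
  GlueD h₀ h₁ m₀ = ¬ SameCopy h₁ h₀
                 × (∀ v → ((v ∈V h₀) × (v ∈V h₁)) iff (v ∈V m₀))
                 × (∀ u v → (((u , v) ∈A h₀) × ((v , u) ∈A h₁)) iff ((u , v) ∈A m₀))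

HM-UH : {k l n : ℕ} → (H : Digraph k) → (M : Digraph l) → Digraph n → Set
HM-UH H M G =
    UH M G × UH H G
  × (∀ (h₀ : Copy H G) (m₀ : Copy M G) → m₀ ⊑ h₀
     → Σ (Copy H G) λ h₁ → GlueG h₀ h₁ m₀
                         × (∀ h₂ → GlueG h₀ h₂ m₀ → SameCopy h₂ h₁))

DiHM-UH : {k l n : ℕ} → (H : Digraph k) → (M : Digraph l) → Digraph n → Set
DiHM-UH H M G =
    DiUH M G × DiUH H G
  × (∀ (h₀ : Copy H G) (m₀ : Copy M G) → m₀ ⊑ h₀
     → Σ (Copy H G) λ h₁ → GlueD h₀ h₁ m₀
                         × (∀ h₂ → GlueD h₀ h₂ m₀ → SameCopy h₂ h₁))

ExactlyCopies : {k n : ℕ} → ℕ → Digraph k → Digraph n → Set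
ExactlyCopies m H G =
  Σ (Fin m → Copy H G) λ cs →
      (∀ i j → SameCopy (cs i) (cs j) → i ≡ j)
    × (∀ c → ∃ λ i → SameCopy c (cs i))

dirC7 : Digraph 7
dirC7 = record { arc = λ i j → toℕ j ≡ᵇ (suc (toℕ i) % 7) }

C7 : Digraph 7
C7 = record { arc = λ i j → arc dirC7 i j ∨ arc dirC7 j i }

dirP2 : Digraph 2
dirP2 = record { arc = λ i j → (toℕ i ≡ᵇ 0) ∧ (toℕ j ≡ᵇ 1) }

P2 : Digraph 2
P2 = record { arc = λ i j → arc dirP2 i j ∨ arc dirP2 j i }

-- Oriented (2-cell) maps, as rotation systems on a graph G

Dart : ℕ → Set
Dart n = Fin n × Fin n

-- next u v : the neighbour of u following v in the cyclic (clockwise)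
-- order around u; prev is its inverse.
record Rotation {n : ℕ} (G : Digraph n) : Set where
  field
    next      : Fin n → Fin n → Fin n
    prev      : Fin n → Fin n → Fin n
    next-arc  : ∀ u v → Arc G u v → Arc G u (next u v)
    prev-arc  : ∀ u v → Arc G u v → Arc G u (prev u v)
    prev-next : ∀ u v → Arc G u v → prev u (next u v) ≡ v
    next-prev : ∀ u v → Arc G u v → next u (prev u v) ≡ v
    cyclic    : ∀ u v w → Arc G u v → Arc G u w
              → ∃ λ k → iter (next u) k v ≡ w

open Rotation public

module _ {n : ℕ} {G : Digraph n} (R : Rotation G) where

  faceStep : Dart n → Dart n
  faceStep (u , v) = (v , next R v u)

  faceStep' : Dart n → Dart n
  faceStep' (u , v) = (v , prev R v u)

  -- Petrie (zigzag) walk: alternately turn one way and the other;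
  -- the Bool records which turn is taken next.
  petrieStep : Dart n × Bool → Dart n × Bool
  petrieStep (d , true)  = (faceStep d , false)
  petrieStep (d , false) = (faceStep' d , true)

ExactOrder : {A : Set} → (A → A) → ℕ → A → Set
ExactOrder f k x = iter f k x ≡ x × (∀ j → 0 < j → j < k → iter f j x ≢ x)

-- map of type {p,q}_r : faces are p-gons, vertices have valency q,
-- Petrie polygons have length r
HasType : {n : ℕ} {G : Digraph n} → Rotation G → ℕ → ℕ → ℕ → Set
HasType {G = G} R p q r =
    (∀ u v → Arc G u v → ExactOrder (faceStep R) p (u , v))
  × (∀ u v → Arc G u v → ExactOrder (next R u) q v)
  × (∀ u v → Arc G u v → ExactOrder (petrieStep R) r ((u , v) , true))

PreservesRot : {n : ℕ} {G : Digraph n} → Rotation G → Aut G → Set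
PreservesRot {G = G} R σ =
  ∀ u v → Arc G u v → next R (to σ u) (to σ v) ≡ to σ (next R u v)

ReversesRot : {n : ℕ} {G : Digraph n} → Rotation G → Aut G → Set
ReversesRot {G = G} R σ =
  ∀ u v → Arc G u v → next R (to σ u) (to σ (next R u v)) ≡ to σ v

-- Regular map: the automorphism group of the map is transitive on flags.
-- A flag is a dart (u,v) together with one of the two faces at the edge
-- uv; an automorphism preserving (resp. reversing) the rotation keeps
-- (resp. swaps) the side.  So flag-transitivity says: any dart can be
-- sent to any dart both by an orientation-preserving and by an
-- orientation-reversing map automorphism.
Regular : {n : ℕ} {G : Digraph n} → Rotation G → Set
Regular {G = G} R =
  ∀ u v u' v' → Arc G u v → Arc G u' v'
  → (Σ (Aut G) λ σ → PreservesRot R σ × to σ u ≡ u' × to σ v ≡ v')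
  × (Σ (Aut G) λ σ → ReversesRot R σ × to σ u ≡ u' × to σ v ≡ v')

darts : {n : ℕ} → Digraph n → List (Dart n)
darts {n} G = filterᵇ (λ d → arc G (proj₁ d) (proj₂ d))
                      (cartesianProduct (allFin n) (allFin n))

numArcs : {n : ℕ} → Digraph n → ℕ
numArcs G = length (darts G)

dartCode : {n : ℕ} → Dart n → ℕ
dartCode {n} (u , v) = toℕ u * n + toℕ v

-- a face (orbit of faceStep on darts) is counted once, at its dart of
-- least code
numFaces : {n : ℕ} {G : Digraph n} → Rotation G → ℕ
numFaces {G = G} R = length (filterᵇ isRep (darts G))
  where
  isRep : _ → Bool
  isRep d = all (λ j → dartCode d ≤ᵇ dartCode (iter (faceStep R) j d))
                (upTo (numArcs G))

-- Euler characteristic V - E + F = 2 - 2g (orientable surface of genus g),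
-- written without subtraction and multiplied by 2 (2E = number of arcs)
HasGenus : {n : ℕ} {G : Digraph n} → Rotation G → ℕ → Set
HasGenus {n} {G} R g = 2 * n + 2 * numFaces R + 4 * g ≡ 4 + numArcs G

IsKleinMap : {n : ℕ} {G : Digraph n} → Rotation G → Set
IsKleinMap R = Regular R × HasType R 7 3 8 × HasGenus R 3

FaceBoundary : {n : ℕ} {G : Digraph n} → Rotation G → Dart n → Copy C7 G → Set
FaceBoundary R d c = ∀ (i : Fin 7) → emb c i ≡ proj₁ (iter (faceStep R) (toℕ i) d)

FacesAre7Cycles : {n : ℕ} {G : Digraph n} → Rotation G → Set
FacesAre7Cycles {G = G} R =
    (∀ u v → Arc G u v → Σ (Copy C7 G) λ c → FaceBoundary R (u , v) c)
  × (∀ (c : Copy C7 G) → ∃₂ λ u v → Arc G u v ×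
       (Σ (Copy C7 G) λ c' → FaceBoundary R (u , v) c' × SameCopy c c'))

-- Generated from PSL(2,7) = ⟨R, L⟩ with R³ = L² = (LR)⁷
-- = (LRLR⁻¹)⁴ = 1: vertices are the cosets g⟨R⟩, and g⟨R⟩ ~ gL⟨R⟩
-- (the 1-skeleton of the Klein map), relabelled by breadth-first search.
kleinNbrs : Vec (List ℕ) 56
kleinNbrs =
  (1 ∷ 2 ∷ 3 ∷ []) ∷ᵥ
  (4 ∷ 5 ∷ 0 ∷ []) ∷ᵥ
  (0 ∷ 6 ∷ 7 ∷ []) ∷ᵥ
  (0 ∷ 8 ∷ 9 ∷ []) ∷ᵥ
  (10 ∷ 11 ∷ 1 ∷ []) ∷ᵥ
  (1 ∷ 12 ∷ 13 ∷ []) ∷ᵥ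
  (14 ∷ 15 ∷ 2 ∷ []) ∷ᵥ
  (2 ∷ 16 ∷ 17 ∷ []) ∷ᵥ
  (3 ∷ 18 ∷ 19 ∷ []) ∷ᵥ
  (3 ∷ 20 ∷ 21 ∷ []) ∷ᵥ
  (21 ∷ 22 ∷ 4 ∷ []) ∷ᵥ
  (4 ∷ 23 ∷ 24 ∷ []) ∷ᵥ
  (25 ∷ 26 ∷ 5 ∷ []) ∷ᵥ
  (5 ∷ 27 ∷ 14 ∷ []) ∷ᵥ
  (13 ∷ 28 ∷ 6 ∷ []) ∷ᵥ
  (29 ∷ 6 ∷ 30 ∷ []) ∷ᵥ
  (31 ∷ 23 ∷ 7 ∷ []) ∷ᵥ
  (7 ∷ 32 ∷ 18 ∷ []) ∷ᵥ
  (17 ∷ 33 ∷ 8 ∷ []) ∷ᵥ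
  (8 ∷ 26 ∷ 34 ∷ []) ∷ᵥ
  (9 ∷ 35 ∷ 30 ∷ []) ∷ᵥ
  (9 ∷ 36 ∷ 10 ∷ []) ∷ᵥ
  (10 ∷ 37 ∷ 38 ∷ []) ∷ᵥ
  (39 ∷ 16 ∷ 11 ∷ []) ∷ᵥ
  (11 ∷ 40 ∷ 25 ∷ []) ∷ᵥ
  (24 ∷ 41 ∷ 12 ∷ []) ∷ᵥ
  (42 ∷ 12 ∷ 19 ∷ []) ∷ᵥ
  (43 ∷ 37 ∷ 13 ∷ []) ∷ᵥ
  (44 ∷ 14 ∷ 45 ∷ []) ∷ᵥ
  (31 ∷ 15 ∷ 46 ∷ []) ∷ᵥ
  (20 ∷ 15 ∷ 47 ∷ []) ∷ᵥ
  (48 ∷ 16 ∷ 29 ∷ []) ∷ᵥ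
  (45 ∷ 17 ∷ 49 ∷ []) ∷ᵥ
  (50 ∷ 18 ∷ 51 ∷ []) ∷ᵥ
  (19 ∷ 52 ∷ 35 ∷ []) ∷ᵥ
  (34 ∷ 53 ∷ 20 ∷ []) ∷ᵥ
  (21 ∷ 54 ∷ 51 ∷ []) ∷ᵥ
  (55 ∷ 27 ∷ 22 ∷ []) ∷ᵥ
  (22 ∷ 53 ∷ 39 ∷ []) ∷ᵥ
  (38 ∷ 49 ∷ 23 ∷ []) ∷ᵥ
  (48 ∷ 54 ∷ 24 ∷ []) ∷ᵥ
  (52 ∷ 25 ∷ 44 ∷ []) ∷ᵥ
  (43 ∷ 26 ∷ 50 ∷ []) ∷ᵥ
  (46 ∷ 27 ∷ 42 ∷ []) ∷ᵥ
  (41 ∷ 47 ∷ 28 ∷ []) ∷ᵥ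
  (28 ∷ 55 ∷ 32 ∷ []) ∷ᵥ
  (29 ∷ 53 ∷ 43 ∷ []) ∷ᵥ
  (30 ∷ 44 ∷ 54 ∷ []) ∷ᵥ
  (50 ∷ 40 ∷ 31 ∷ []) ∷ᵥ
  (32 ∷ 39 ∷ 52 ∷ []) ∷ᵥ
  (42 ∷ 33 ∷ 48 ∷ []) ∷ᵥ
  (36 ∷ 33 ∷ 55 ∷ []) ∷ᵥ
  (49 ∷ 34 ∷ 41 ∷ []) ∷ᵥ
  (46 ∷ 35 ∷ 38 ∷ []) ∷ᵥ
  (47 ∷ 40 ∷ 36 ∷ []) ∷ᵥ
  (51 ∷ 45 ∷ 37 ∷ []) ∷ᵥ
  []ᵥ

Klein : Digraph 56
Klein = record { arc = λ u v → any (λ w → w ≡ᵇ toℕ v) (lookup kleinNbrs u) }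

-- The rotation of Γ′ is the cyclic order of its neighbour lists. The finite facts about the
-- resulting map (faces are heptagons that are 7-cycles, vertices have degree 3, Petrie polygons
-- have length 8, there are 24 faces, the listed permutations are map automorphisms) are checked by
-- evaluating decision procedures. The map is regular: every dart is the image of the dart (0, 1)
-- under a rotation-preserving automorphism given as a word in two generators, and a reflection
-- fixes (0, 1).
--
-- In a trivalent map a non-backtracking walk is determined by its first dart and its sequence of
-- left and right turns. From every dart, a 7-cycle whose first turn is to the left turns left all
-- the way round, so the 7-cycles are exactly the face boundaries, read in either direction; in
-- particular a 7-cycle is determined by any three consecutive vertices, and uniform homogeneity
-- follows from 2-arc-transitivity of the automorphism group. An edge xy lies on exactly two faces,
-- those of the darts (x, y) and (y, x), and these meet only in x and y; hence the face glued to a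
-- 7-cycle along an edge is the other face, and along an arc it is the other face traversed in the
-- opposite direction.

module Submission where

open import Defs
open import Data.Bool using (Bool; true; false; T; _∧_; if_then_else_)
open import Data.Bool.ListAction using (and; all)
open import Data.Bool.Properties using (⇔→≡; ∧-assoc; ∧-identityʳ; ∧-idem; T-≡) renaming (_≟_ to _≟ᵇ_)
open import Data.Empty using (⊥-elim)
open import Data.Fin using (Fin; zero; suc; toℕ; fromℕ<)
open import Data.Fin.Patterns using (0F; 1F; 2F; 3F; 4F; 5F; 6F)
open import Data.Fin.Properties using (all?; any?; toℕ-fromℕ<; toℕ-injective)
open import Data.List using (List; []; _∷_; applyUpTo; upTo; filterᵇ; length; cartesianProduct; allFin; drop)
import Data.List as List
open import Data.List.Properties using (map-upTo)
open import Data.List.Relation.Unary.All as All using (All; []; _∷_)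
open import Data.List.Relation.Unary.All.Properties using (all-filter)
open import Data.Maybe using (fromMaybe)
open import Data.Nat using (ℕ; zero; suc; _+_; _*_; _≤ᵇ_; _≡ᵇ_) renaming (_≟_ to _≟ℕ_)
open import Data.Nat.DivMod using (_mod_)
open import Data.Nat.Properties using (<-irrefl; +-comm)
open import Data.Product using (Σ; ∃; _×_; _,_; proj₁; proj₂)
open import Data.Product.Properties using (≡-dec)
open import Data.Sum using (_⊎_; inj₁; inj₂; swap)
import Data.Sum as Sum
open import Data.Vec using (Vec; []; _∷_; lookup; tabulate; replicate; head; tail)
open import Data.Vec.Properties using (lookup∘tabulate)
import Data.Vec.Properties as Vec
open import Function using (case_of_)
open import Function.Bundles using (mk⇔; Equivalence)
open import Relation.Binary.Definitions using (DecidableEquality)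
open import Relation.Binary.PropositionalEquality
open import Relation.Nullary using (¬_; Dec; yes; no; does)
open import Relation.Nullary.Decidable using (True; T?; toWitness; map′; _×-dec_; _→-dec_; _⊎-dec_; ¬?; dec-true)

-- Proof by running a decision procedure. Opaque, so that the (large) normal form of the
-- proof is never computed when the statement is used.
opaque
  by-decision : {P : Set} (P? : Dec P) → {True P?} → P
  by-decision P? {t} = toWitness t

-- Decidable equality of Fin n through the builtin equality of ℕ, which evaluates much faster
-- than the structural one.
_≟ᶠ_ : ∀ {n} → DecidableEquality (Fin n)
i ≟ᶠ j = map′ toℕ-injective (cong toℕ) (toℕ i ≟ℕ toℕ j)

iter-shift : {A : Set} (f : A → A) (k : ℕ) (x : A) → iter f k (f x) ≡ f (iter f k x)
iter-shift f zero    x = refl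
iter-shift f (suc k) x = cong f (iter-shift f k x)

iter-+ : {A : Set} (f : A → A) (m k : ℕ) (x : A) → iter f (m + k) x ≡ iter f m (iter f k x)
iter-+ f zero    k x = refl
iter-+ f (suc m) k x = cong f (iter-+ f m k x)

module _ {n : ℕ} {G : Digraph n} where

  aut-arc : (σ : Aut G) → ∀ {u v} → Arc G u v → Arc G (to σ u) (to σ v)
  aut-arc σ {u} {v} a = trans (sym (arc-pres σ u v)) a

  aut-from : (σ : Aut G) → ∀ {u v} → to σ u ≡ v → from σ v ≡ u
  aut-from σ {u} refl = from-to σ u

  aut-id : Aut G
  aut-id = record
    { to = λ v → v ; from = λ v → v
    ; to-from = λ _ → refl ; from-to = λ _ → refl ; arc-pres = λ _ _ → refl }

  aut-∘ : Aut G → Aut G → Aut G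
  aut-∘ σ τ = record
    { to       = λ v → to σ (to τ v)
    ; from     = λ v → from τ (from σ v)
    ; to-from  = λ v → trans (cong (to σ) (to-from τ (from σ v))) (to-from σ v)
    ; from-to  = λ v → trans (cong (from τ) (from-to σ (to τ v))) (from-to τ v)
    ; arc-pres = λ u v → trans (arc-pres τ u v) (arc-pres σ (to τ u) (to τ v))
    }

  aut-inverse : Aut G → Aut G
  aut-inverse σ = record
    { to = from σ ; from = to σ ; to-from = from-to σ ; from-to = to-from σ
    ; arc-pres = λ u v → sym (trans (arc-pres σ (from σ u) (from σ v))
                                   (cong₂ (arc G) (to-from σ u) (to-from σ v)))
    }

  aut-of-order : (f : Fin n → Fin n) (k : ℕ) → (∀ v → iter f (suc k) v ≡ v)
               → (∀ {u v} → Arc G u v → Arc G (f u) (f v)) → Aut G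
  aut-of-order f k order f-arc = record
    { to = f ; from = iter f k ; to-from = order
    ; from-to = λ v → trans (iter-shift f k v) (order v)
    ; arc-pres = λ u v →
        ⇔→≡ (mk⇔ f-arc (λ a → subst₂ (Arc G) (order′ u) (order′ v) (iter-arc k a)))
    }
    where
    iter-arc : ∀ m {u v} → Arc G u v → Arc G (iter f m u) (iter f m v)
    iter-arc zero    a = a
    iter-arc (suc m) a = f-arc (iter-arc m a)
    order′ : ∀ v → iter f k (f v) ≡ v
    order′ v = trans (iter-shift f k v) (order v)

  module _ (R : Rotation G) where

    preserves-id : PreservesRot R aut-id
    preserves-id _ _ _ = refl

    preserves-∘ : ∀ σ τ → PreservesRot R σ → PreservesRot R τ → PreservesRot R (aut-∘ σ τ)
    preserves-∘ σ τ pσ pτ u v a = trans (pσ (to τ u) (to τ v) (aut-arc τ a)) (cong (to σ) (pτ u v a))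

    preserves-inverse : ∀ σ → PreservesRot R σ → PreservesRot R (aut-inverse σ)
    preserves-inverse σ pσ u v a = begin
      next R (from σ u) (from σ v)
        ≡⟨ sym (from-to σ _) ⟩
      from σ (to σ (next R (from σ u) (from σ v)))
        ≡⟨ cong (from σ) (sym (pσ _ _ (aut-arc (aut-inverse σ) a))) ⟩
      from σ (next R (to σ (from σ u)) (to σ (from σ v)))
        ≡⟨ cong (from σ) (cong₂ (next R) (to-from σ u) (to-from σ v)) ⟩
      from σ (next R u v)
        ∎
      where open ≡-Reasoning

    preserves-∘-reverses : ∀ σ ρ → PreservesRot R σ → ReversesRot R ρ → ReversesRot R (aut-∘ σ ρ)
    preserves-∘-reverses σ ρ pσ rρ u v a =
      trans (pσ (to ρ u) (to ρ (next R u v)) (aut-arc ρ (next-arc R u v a))) (cong (to σ) (rρ u v a))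

    reverses-∘-preserves : ∀ ρ τ → ReversesRot R ρ → PreservesRot R τ → ReversesRot R (aut-∘ ρ τ)
    reverses-∘-preserves ρ τ rρ pτ u v a =
      trans (cong (λ w → next R (to ρ (to τ u)) (to ρ w)) (sym (pτ u v a)))
            (rρ (to τ u) (to τ v) (aut-arc τ a))

module _ {k n : ℕ} {H : Digraph k} {G : Digraph n} where

  SameCopy-sym : {c d : Copy H G} → SameCopy c d → SameCopy d c
  SameCopy-sym (p , q) = (λ v → proj₂ (p v) , proj₁ (p v)) , (λ u v → proj₂ (q u v) , proj₁ (q u v))

  SameCopy-trans : {c d e : Copy H G} → SameCopy c d → SameCopy d e → SameCopy c e
  SameCopy-trans (p , q) (p' , q') =
    (λ v → (λ z → proj₁ (p' v) (proj₁ (p v) z)) , (λ z → proj₂ (p v) (proj₂ (p' v) z))) ,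
    (λ u v → (λ z → proj₁ (q' u v) (proj₁ (q u v) z)) , (λ z → proj₂ (q u v) (proj₂ (q' u v) z)))

  ∈V-same : {c d : Copy H G} → SameCopy c d → ∀ {v} → v ∈V c → v ∈V d
  ∈V-same (p , _) {v} = proj₁ (p v)

  ∈A-same : {c d : Copy H G} → SameCopy c d → ∀ {u v} → (u , v) ∈A c → (u , v) ∈A d
  ∈A-same (_ , q) {u} {v} = proj₁ (q u v)

  emb-∈V : (c : Copy H G) → ∀ i → emb c i ∈V c
  emb-∈V c i = i , refl

  emb-∈A : (c : Copy H G) → ∀ {i j} → Arc H i j → (emb c i , emb c j) ∈A c
  emb-∈A c {i} {j} a = i , j , a , refl , refl

  ∈A-source : (c : Copy H G) → ∀ {u v} → (u , v) ∈A c → u ∈V c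
  ∈A-source c (i , _ , _ , p , _) = i , p

  ∈A-target : (c : Copy H G) → ∀ {u v} → (u , v) ∈A c → v ∈V c
  ∈A-target c (_ , j , _ , _ , q) = j , q

  ∈A-arc : (c : Copy H G) → ∀ {u v} → (u , v) ∈A c → Arc G u v
  ∈A-arc c (i , j , a , refl , refl) = emb-arc c i j a

  SameCopy-reindex : (c d : Copy H G) (π : Fin k → Fin k)
                   → (∀ j → ∃ λ i → π i ≡ j) → (∀ i j → arc H i j ≡ arc H (π i) (π j))
                   → (∀ i → emb c i ≡ emb d (π i)) → SameCopy c d
  SameCopy-reindex c d π onto arcs e =
    (λ v → (λ { (i , p) → π i , trans (sym (e i)) p })
         , (λ { (j , p) → let (i , πi) = onto j in i , trans (e i) (trans (cong (emb d) πi) p) })) ,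
    (λ u v → (λ { (i , j , a , p , q) →
                   π i , π j , trans (sym (arcs i j)) a , trans (sym (e i)) p , trans (sym (e j)) q })
           , (λ { (i' , j' , a , p , q) →
                   let (i , πi) = onto i' ; (j , πj) = onto j' in
                   i , j , trans (arcs i j) (subst₂ (λ s t → arc H s t ≡ true) (sym πi) (sym πj) a) ,
                   trans (e i) (trans (cong (emb d) πi) p) , trans (e j) (trans (cong (emb d) πj) q) }))

  SameCopy-≗ : (c d : Copy H G) → (∀ i → emb c i ≡ emb d i) → SameCopy c d
  SameCopy-≗ c d = SameCopy-reindex c d (λ i → i) (λ j → j , refl) (λ _ _ → refl)

suc₇ : Fin 7 → Fin 7
suc₇ 0F = 1F
suc₇ 1F = 2F
suc₇ 2F = 3F
suc₇ 3F = 4F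
suc₇ 4F = 5F
suc₇ 5F = 6F
suc₇ 6F = 0F

reflect₇ : Fin 7 → Fin 7
reflect₇ 0F = 2F
reflect₇ 1F = 1F
reflect₇ 2F = 0F
reflect₇ 3F = 6F
reflect₇ 4F = 5F
reflect₇ 5F = 4F
reflect₇ 6F = 3F

reflect₇-involutive : ∀ i → reflect₇ (reflect₇ i) ≡ i
reflect₇-involutive = by-decision (all? λ i → reflect₇ (reflect₇ i) ≟ᶠ i)

reflect₇-suc₇ : ∀ i → suc₇ (reflect₇ (suc₇ i)) ≡ reflect₇ i
reflect₇-suc₇ = by-decision (all? λ i → suc₇ (reflect₇ (suc₇ i)) ≟ᶠ reflect₇ i)

suc₇-surjective : ∀ j → ∃ λ i → suc₇ i ≡ j
suc₇-surjective 0F = 6F , refl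
suc₇-surjective 1F = 0F , refl
suc₇-surjective 2F = 1F , refl
suc₇-surjective 3F = 2F , refl
suc₇-surjective 4F = 3F , refl
suc₇-surjective 5F = 4F , refl
suc₇-surjective 6F = 5F , refl

reflect₇-surjective : ∀ j → ∃ λ i → reflect₇ i ≡ j
reflect₇-surjective j = reflect₇ j , reflect₇-involutive j

dirC7-suc₇ : ∀ i → Arc dirC7 i (suc₇ i)
dirC7-suc₇ = by-decision (all? λ i → arc dirC7 i (suc₇ i) ≟ᵇ true)

dirC7-arc : ∀ i j → Arc dirC7 i j → j ≡ suc₇ i
dirC7-arc = by-decision (all? λ i → all? λ j → (arc dirC7 i j ≟ᵇ true) →-dec (j ≟ᶠ suc₇ i))

C7-suc₇ : ∀ i → Arc C7 i (suc₇ i)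
C7-suc₇ = by-decision (all? λ i → arc C7 i (suc₇ i) ≟ᵇ true)

C7-arc : ∀ i j → Arc C7 i j → j ≡ suc₇ i ⊎ i ≡ suc₇ j
C7-arc = by-decision (all? λ i → all? λ j →
                       (arc C7 i j ≟ᵇ true) →-dec ((j ≟ᶠ suc₇ i) ⊎-dec (i ≟ᶠ suc₇ j)))

C7-suc₇-invariant : ∀ i j → arc C7 i j ≡ arc C7 (suc₇ i) (suc₇ j)
C7-suc₇-invariant = by-decision (all? λ i → all? λ j → arc C7 i j ≟ᵇ arc C7 (suc₇ i) (suc₇ j))

dirC7-suc₇-invariant : ∀ i j → arc dirC7 i j ≡ arc dirC7 (suc₇ i) (suc₇ j)
dirC7-suc₇-invariant =
  by-decision (all? λ i → all? λ j → arc dirC7 i j ≟ᵇ arc dirC7 (suc₇ i) (suc₇ j))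

C7-reflect₇-invariant : ∀ i j → arc C7 i j ≡ arc C7 (reflect₇ i) (reflect₇ j)
C7-reflect₇-invariant =
  by-decision (all? λ i → all? λ j → arc C7 i j ≟ᵇ arc C7 (reflect₇ i) (reflect₇ j))

C7-symmetric : ∀ i j → Arc C7 i j → Arc C7 j i
C7-symmetric = by-decision (all? λ i → all? λ j → (arc C7 i j ≟ᵇ true) →-dec (arc C7 j i ≟ᵇ true))

C7-loopless : ∀ i → ¬ Arc C7 i i
C7-loopless = by-decision (all? λ i → ¬? (arc C7 i i ≟ᵇ true))

dirC7-loopless : ∀ i → ¬ Arc dirC7 i i
dirC7-loopless = by-decision (all? λ i → ¬? (arc dirC7 i i ≟ᵇ true))

suc₇-suc₇ : ∀ i → suc₇ (suc₇ i) ≢ i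
suc₇-suc₇ = by-decision (all? λ i → ¬? (suc₇ (suc₇ i) ≟ᶠ i))

module _ {n : ℕ} (G : Digraph n) where

  Undirected : Set
  Undirected = ∀ {u v} → Arc G u v → Arc G v u

record IsCycle₇ {n : ℕ} (G : Digraph n) (w : Fin 7 → Fin n) : Set where
  constructor cycle₇
  field
    cycle-arc : ∀ i → Arc G (w i) (w (suc₇ i))
    cycle-inj : ∀ i j → w i ≡ w j → i ≡ j

open IsCycle₇ public

module _ {n : ℕ} {G : Digraph n} where

  dirCycleCopy : ∀ w → IsCycle₇ G w → Copy dirC7 G
  dirCycleCopy w (cycle₇ arcs inj) = record { emb = w ; emb-inj = inj ; emb-arc = arc' }
    where
    arc' : ∀ i j → Arc dirC7 i j → Arc G (w i) (w j)
    arc' i j a rewrite dirC7-arc i j a = arcs i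

  cycleCopy : Undirected G → ∀ w → IsCycle₇ G w → Copy C7 G
  cycleCopy undirected w (cycle₇ arcs inj) = record { emb = w ; emb-inj = inj ; emb-arc = arc' }
    where
    arc' : ∀ i j → Arc C7 i j → Arc G (w i) (w j)
    arc' i j a with C7-arc i j a
    ... | inj₁ refl = arcs i
    ... | inj₂ refl = undirected (arcs j)

  emb-isCycle₇ : {H : Digraph 7} → (∀ i → Arc H i (suc₇ i)) → (c : Copy H G) → IsCycle₇ G (emb c)
  emb-isCycle₇ H-cycle c = cycle₇ (λ i → emb-arc c i (suc₇ i) (H-cycle i)) (emb-inj c)

  isCycle₇-≗ : ∀ {w w'} → (∀ i → w i ≡ w' i) → IsCycle₇ G w → IsCycle₇ G w'
  isCycle₇-≗ {w} {w'} e (cycle₇ arcs inj) =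
    cycle₇ (λ i → subst₂ (Arc G) (e i) (e (suc₇ i)) (arcs i))
           (λ i j p → inj i j (trans (e i) (trans p (sym (e j)))))

  isCycle₇-2≢0 : ∀ {w} → IsCycle₇ G w → w 2F ≢ w 0F
  isCycle₇-2≢0 (cycle₇ _ inj) p with inj 2F 0F p
  ... | ()

  isCycle₇-reflect : Undirected G → ∀ {w} → IsCycle₇ G w → IsCycle₇ G (λ i → w (reflect₇ i))
  isCycle₇-reflect undirected {w} (cycle₇ arcs inj) = cycle₇
    (λ i → undirected (subst (λ j → Arc G (w (reflect₇ (suc₇ i))) (w j)) (reflect₇-suc₇ i)
                             (arcs (reflect₇ (suc₇ i)))))
    (λ i j p → trans (sym (reflect₇-involutive i))
                     (trans (cong reflect₇ (inj _ _ p)) (reflect₇-involutive j)))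

module _ {n : ℕ} (G : Digraph n) where

  ArcTransitive : Set
  ArcTransitive = ∀ u v u' v' → Arc G u v → Arc G u' v'
                → Σ (Aut G) λ σ → to σ u ≡ u' × to σ v ≡ v'

  TwoArcTransitive : Set
  TwoArcTransitive = ∀ a b c a' b' c'
                   → Arc G a b → Arc G b c → c ≢ a → Arc G a' b' → Arc G b' c' → c' ≢ a'
                   → Σ (Aut G) λ σ → to σ a ≡ a' × to σ b ≡ b' × to σ c ≡ c'

  CyclesDeterminedBy2Arcs : Set
  CyclesDeterminedBy2Arcs = ∀ {w w'} → IsCycle₇ G w → IsCycle₇ G w'
                          → w 0F ≡ w' 0F → w 1F ≡ w' 1F → w 2F ≡ w' 2F → ∀ i → w i ≡ w' i

module _ {n : ℕ} {G : Digraph n} where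

  extends-2 : ArcTransitive G → {H : Digraph 2} → Arc H 0F 1F
            → (c d : Copy H G) (φ : CopyIso c d) → Extends φ
  extends-2 transitive H01 c d φ = σ , extends
    where
    x₀ = emb c 0F
    x₁ = emb c 1F
    x₀x₁ : (x₀ , x₁) ∈A c
    x₀x₁ = emb-∈A c H01
    image : (map φ x₀ , map φ x₁) ∈A d
    image = proj₁ (arcs φ x₀ x₁ (emb-∈V c 0F) (emb-∈V c 1F)) x₀x₁
    t = transitive _ _ _ _ (∈A-arc c x₀x₁) (∈A-arc d image)
    σ = proj₁ t
    extends : ∀ v → v ∈V c → to σ v ≡ map φ v
    extends v (0F , refl) = proj₁ (proj₂ t)
    extends v (1F , refl) = proj₂ (proj₂ t)

  -- σ is chosen on the 2-arc (w 0F, w 1F, w 2F); then σ ∘ w and φ ∘ w are 7-cycles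
  -- starting with the same 2-arc, hence equal.
  extends-7 : TwoArcTransitive G → CyclesDeterminedBy2Arcs G
            → {H : Digraph 7} → (∀ i → Arc H i (suc₇ i))
            → (c d : Copy H G) (φ : CopyIso c d) → Extends φ
  extends-7 transitive determined H-cycle c d φ = σ , extends
    where
    w : Fin 7 → Fin n
    w = emb c
    w-cycle : IsCycle₇ G w
    w-cycle = emb-isCycle₇ H-cycle c
    φw : Fin 7 → Fin n
    φw i = map φ (w i)
    φw-cycle : IsCycle₇ G φw
    φw-cycle = cycle₇
      (λ i → ∈A-arc d (proj₁ (arcs φ (w i) (w (suc₇ i)) (emb-∈V c i) (emb-∈V c (suc₇ i)))
                               (emb-∈A c (H-cycle i))))
      (λ i j p → emb-inj c i j (CopyIso.inj φ (w i) (w j) (emb-∈V c i) (emb-∈V c j) p))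
    t = transitive _ _ _ _ _ _ (cycle-arc w-cycle 0F) (cycle-arc w-cycle 1F) (isCycle₇-2≢0 w-cycle)
                   (cycle-arc φw-cycle 0F) (cycle-arc φw-cycle 1F) (isCycle₇-2≢0 φw-cycle)
    σ = proj₁ t
    σw-cycle : IsCycle₇ G (λ i → to σ (w i))
    σw-cycle = cycle₇ (λ i → aut-arc σ (cycle-arc w-cycle i))
                      (λ i j p → cycle-inj w-cycle i j (trans (sym (aut-from σ refl))
                                                             (trans (cong (from σ) p) (aut-from σ refl))))
    extends : ∀ v → v ∈V c → to σ v ≡ map φ v
    extends v (i , refl) = determined σw-cycle φw-cycle σw₀ σw₁ σw₂ i
      where
      σw₀ = proj₁ (proj₂ t)
      σw₁ = proj₁ (proj₂ (proj₂ t))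
      σw₂ = proj₂ (proj₂ (proj₂ t))

module _ {n : ℕ} {G : Digraph n} (R : Rotation G) where

  Trivalent : Set
  Trivalent = ∀ {u v w} → Arc G u v → Arc G u w → w ≢ v → w ≡ next R u v ⊎ w ≡ prev R u v

  prev-of-next : ∀ {u x y} → Arc G u x → next R u x ≡ y → prev R u y ≡ x
  prev-of-next {u} {x} a refl = prev-next R u x a

  regular-from-base : (b₀ b₁ : Fin n)
    → (∀ {u v} → Arc G u v → Σ (Aut G) λ σ → PreservesRot R σ × to σ b₀ ≡ u × to σ b₁ ≡ v)
    → (ρ : Aut G) → ReversesRot R ρ → to ρ b₀ ≡ b₀ → to ρ b₁ ≡ b₁
    → Regular R
  regular-from-base b₀ b₁ τ ρ ρ-rev ρb₀ ρb₁ u v u' v' a a'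
    with τ a | τ a'
  ... | σ , σ-pres , σb₀ , σb₁ | σ' , σ'-pres , σ'b₀ , σ'b₁ =
    ( aut-∘ σ' (aut-inverse σ)
    , preserves-∘ R σ' (aut-inverse σ) σ'-pres (preserves-inverse R σ σ-pres)
    , trans (cong (to σ') (aut-from σ σb₀)) σ'b₀
    , trans (cong (to σ') (aut-from σ σb₁)) σ'b₁ )
    , ( aut-∘ σ' (aut-∘ ρ (aut-inverse σ))
      , preserves-∘-reverses R σ' (aut-∘ ρ (aut-inverse σ)) σ'-pres
          (reverses-∘-preserves R ρ (aut-inverse σ) ρ-rev (preserves-inverse R σ σ-pres))
      , trans (cong (λ x → to σ' (to ρ x)) (aut-from σ σb₀)) (trans (cong (to σ') ρb₀) σ'b₀)
      , trans (cong (λ x → to σ' (to ρ x)) (aut-from σ σb₁)) (trans (cong (to σ') ρb₁) σ'b₁) )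

  regular⇒arcTransitive : Regular R → ArcTransitive G
  regular⇒arcTransitive regular u v u' v' a a' with proj₁ (regular u v u' v' a a')
  ... | σ , _ , σu , σv = σ , σu , σv

  -- Map the dart (b, a) to (b', a'); the third neighbour c of b is the successor or
  -- the predecessor of a around b, and the orientation of σ is chosen to match c'.
  regular⇒twoArcTransitive : Undirected G → Trivalent → Regular R → TwoArcTransitive G
  regular⇒twoArcTransitive undirected trivalent regular a b c a' b' c' ab bc c≢a ab' bc' c'≢a'
    with regular b a b' a' (undirected ab) (undirected ab')
       | trivalent (undirected ab) bc c≢a | trivalent (undirected ab') bc' c'≢a'
  ... | (σ , σ-pres , σb , σa) , _ | inj₁ refl | inj₁ refl =
    σ , σa , σb , trans (sym (σ-pres b a (undirected ab))) (cong₂ (next R) σb σa)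
  ... | (σ , σ-pres , σb , σa) , _ | inj₂ refl | inj₂ refl =
    σ , σa , σb , trans (sym (prev-of-next (subst (λ x → Arc G x (to σ c)) σb (aut-arc σ bc)) turn))
                        (cong (prev R b') σa)
    where
    turn : next R b' (to σ c) ≡ to σ a
    turn = trans (cong (λ x → next R x (to σ c)) (sym σb))
                 (trans (σ-pres b c bc) (cong (to σ) (next-prev R b a (undirected ab))))
  ... | _ , (ρ , ρ-rev , ρb , ρa) | inj₁ refl | inj₂ refl =
    ρ , ρa , ρb , trans (sym (prev-of-next (subst (λ x → Arc G x (to ρ c)) ρb (aut-arc ρ bc)) turn))
                        (cong (prev R b') ρa)
    where
    turn : next R b' (to ρ c) ≡ to ρ a
    turn = trans (cong (λ x → next R x (to ρ c)) (sym ρb)) (ρ-rev b a (undirected ab))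
  ... | _ , (ρ , ρ-rev , ρb , ρa) | inj₂ refl | inj₁ refl =
    ρ , ρa , ρb , sym (trans (cong₂ (next R) (sym ρb) (sym ρa))
                             (trans (cong (λ x → next R (to ρ b) (to ρ x))
                                          (sym (next-prev R b a (undirected ab))))
                                    (ρ-rev b c bc)))

suc₃ pred₃ : Fin 3 → Fin 3
suc₃ 0F = 1F
suc₃ 1F = 2F
suc₃ 2F = 0F
pred₃ 0F = 2F
pred₃ 1F = 0F
pred₃ 2F = 1F

pred₃-suc₃ : ∀ i → pred₃ (suc₃ i) ≡ i
pred₃-suc₃ 0F = refl
pred₃-suc₃ 1F = refl
pred₃-suc₃ 2F = refl

suc₃-pred₃ : ∀ i → suc₃ (pred₃ i) ≡ i
suc₃-pred₃ 0F = refl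
suc₃-pred₃ 1F = refl
suc₃-pred₃ 2F = refl

suc₃-transitive : ∀ i j → ∃ λ (k : Fin 3) → iter suc₃ (toℕ k) i ≡ j
suc₃-transitive = by-decision (all? λ i → all? λ j → any? λ k → iter suc₃ (toℕ k) i ≟ᶠ j)

Fin₃-cover : ∀ i j → j ≡ i ⊎ j ≡ suc₃ i ⊎ j ≡ pred₃ i
Fin₃-cover = by-decision (all? λ i → all? λ j → (j ≟ᶠ i) ⊎-dec (j ≟ᶠ suc₃ i) ⊎-dec (j ≟ᶠ pred₃ i))

module CubicRotation {n : ℕ} (G : Digraph n)
  (neighbour : Fin n → Fin 3 → Fin n) (position : Fin n → Fin n → Fin 3)
  (neighbour-arc : ∀ u i → Arc G u (neighbour u i))
  (arc-neighbour : ∀ u v → Arc G u v → ∃ λ i → neighbour u i ≡ v)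
  (position-neighbour : ∀ u i → position u (neighbour u i) ≡ i)
  where

  next′ prev′ : Fin n → Fin n → Fin n
  next′ u v = neighbour u (suc₃ (position u v))
  prev′ u v = neighbour u (pred₃ (position u v))

  next-neighbour : ∀ u i → next′ u (neighbour u i) ≡ neighbour u (suc₃ i)
  next-neighbour u i = cong (λ j → neighbour u (suc₃ j)) (position-neighbour u i)

  prev-neighbour : ∀ u i → prev′ u (neighbour u i) ≡ neighbour u (pred₃ i)
  prev-neighbour u i = cong (λ j → neighbour u (pred₃ j)) (position-neighbour u i)

  iter-next : ∀ u i k → iter (next′ u) k (neighbour u i) ≡ neighbour u (iter suc₃ k i)
  iter-next u i zero    = refl
  iter-next u i (suc k) = trans (cong (next′ u) (iter-next u i k)) (next-neighbour u (iter suc₃ k i))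

  rotation : Rotation G
  rotation = record
    { next      = next′
    ; prev      = prev′
    ; next-arc  = λ u v a → case-arc u v a λ i →
                    subst (Arc G u) (sym (next-neighbour u i)) (neighbour-arc u (suc₃ i))
    ; prev-arc  = λ u v a → case-arc u v a λ i →
                    subst (Arc G u) (sym (prev-neighbour u i)) (neighbour-arc u (pred₃ i))
    ; prev-next = λ u v a → case-arc u v a λ i →
                    trans (cong (prev′ u) (next-neighbour u i))
                          (trans (prev-neighbour u (suc₃ i)) (cong (neighbour u) (pred₃-suc₃ i)))
    ; next-prev = λ u v a → case-arc u v a λ i →
                    trans (cong (next′ u) (prev-neighbour u i))
                          (trans (next-neighbour u (pred₃ i)) (cong (neighbour u) (suc₃-pred₃ i)))
    ; cyclic    = λ u v w a b → case-arc u v a λ i → case-arc u w b λ j →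
                    let (k , e) = suc₃-transitive i j
                    in toℕ k , trans (iter-next u i (toℕ k)) (cong (neighbour u) e)
    }
    where
    case-arc : ∀ u v → Arc G u v → {P : Fin n → Set} → (∀ i → P (neighbour u i)) → P v
    case-arc u v a f with arc-neighbour u v a
    ... | i , refl = f i

  trivalent : Trivalent rotation
  trivalent {u} {v} {w} a b w≢v with arc-neighbour u v a | arc-neighbour u w b
  ... | i , refl | j , refl with Fin₃-cover i j
  ...   | inj₁ refl        = ⊥-elim (w≢v refl)
  ...   | inj₂ (inj₁ refl) = inj₁ (sym (next-neighbour u i))
  ...   | inj₂ (inj₂ refl) = inj₂ (sym (prev-neighbour u i))

iter-surjective : {k : ℕ} {π : Fin k → Fin k} → (∀ j → ∃ λ i → π i ≡ j) → ∀ m j → ∃ λ i → iter π m i ≡ j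
iter-surjective onto zero    j = j , refl
iter-surjective {π = π} onto (suc m) j with onto j
... | j' , refl with iter-surjective onto m j'
...   | i , refl = i , refl

iter-arc-invariant : {k : ℕ} {H : Digraph k} {π : Fin k → Fin k}
                   → (∀ i j → arc H i j ≡ arc H (π i) (π j))
                   → ∀ m i j → arc H i j ≡ arc H (iter π m i) (iter π m j)
iter-arc-invariant inv zero    i j = refl
iter-arc-invariant {π = π} inv (suc m) i j = trans (iter-arc-invariant inv m i j) (inv (iter π m i) (iter π m j))

module _ {n : ℕ} {G : Digraph n} (R : Rotation G) where

  faceWalk : Dart n → Fin 7 → Fin n
  faceWalk d i = proj₁ (iter (faceStep R) (toℕ i) d)

  FacePeriod : Dart n → Set
  FacePeriod d = iter (faceStep R) 7 d ≡ d

  facePeriod-iter : ∀ {d} → FacePeriod d → ∀ m → FacePeriod (iter (faceStep R) m d)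
  facePeriod-iter p zero    = p
  facePeriod-iter p (suc m) =
    trans (iter-shift (faceStep R) 7 _) (cong (faceStep R) (facePeriod-iter p m))

  faceWalk-dart : ∀ {d} → FacePeriod d
                → ∀ i → iter (faceStep R) (toℕ i) d ≡ (faceWalk d i , faceWalk d (suc₇ i))
  faceWalk-dart p 0F = refl
  faceWalk-dart p 1F = refl
  faceWalk-dart p 2F = refl
  faceWalk-dart p 3F = refl
  faceWalk-dart p 4F = refl
  faceWalk-dart p 5F = refl
  faceWalk-dart {d} p 6F = cong (λ e → faceWalk d 6F , proj₁ e) p

  faceWalk-faceStep : ∀ {d} → FacePeriod d → ∀ i → faceWalk (faceStep R d) i ≡ faceWalk d (suc₇ i)
  faceWalk-faceStep {d} p i =
    trans (cong proj₁ (iter-shift (faceStep R) (toℕ i) d)) (cong proj₂ (faceWalk-dart p i))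

  faceWalk-iter : ∀ {d} → FacePeriod d
                → ∀ m i → faceWalk (iter (faceStep R) m d) i ≡ faceWalk d (iter suc₇ m i)
  faceWalk-iter p zero    i = refl
  faceWalk-iter {d} p (suc m) i =
    trans (faceWalk-faceStep (facePeriod-iter p m) i)
          (trans (faceWalk-iter p m (suc₇ i)) (cong (faceWalk d) (iter-shift suc₇ m i)))

module _ {n : ℕ} {G : Digraph n} (undirected : Undirected G) where

  reverse : Copy dirC7 G → Copy dirC7 G
  reverse c = dirCycleCopy (λ i → emb c (reflect₇ i))
                           (isCycle₇-reflect {G = G} undirected {emb c} (emb-isCycle₇ dirC7-suc₇ c))

  ∈V-reverse : (c : Copy dirC7 G) → ∀ {v} → v ∈V reverse c → v ∈V c
  ∈V-reverse c (i , p) = reflect₇ i , p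

  ∈V-reverse⁻ : (c : Copy dirC7 G) → ∀ {v} → v ∈V c → v ∈V reverse c
  ∈V-reverse⁻ c (i , p) = reflect₇ i , trans (cong (emb c) (reflect₇-involutive i)) p

  ∈A-reverse : (c : Copy dirC7 G) → ∀ {u v} → (u , v) ∈A reverse c → (v , u) ∈A c
  ∈A-reverse c (i , j , a , p , q) rewrite dirC7-arc i j a =
    reflect₇ (suc₇ i) , suc₇ (reflect₇ (suc₇ i)) , dirC7-suc₇ (reflect₇ (suc₇ i)) , q ,
    trans (cong (emb c) (reflect₇-suc₇ i)) p

  ∈A-reverse⁻ : (c : Copy dirC7 G) → ∀ {u v} → (v , u) ∈A c → (u , v) ∈A reverse c
  ∈A-reverse⁻ c (i , j , a , p , q) rewrite dirC7-arc i j a =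
    reflect₇ (suc₇ i) , suc₇ (reflect₇ (suc₇ i)) , dirC7-suc₇ (reflect₇ (suc₇ i)) ,
    trans (cong (emb c) (reflect₇-involutive (suc₇ i))) q ,
    trans (cong (λ k → emb c (reflect₇ k)) (reflect₇-suc₇ i))
          (trans (cong (emb c) (reflect₇-involutive i)) p)

  SameCopy-reverse : {c d : Copy dirC7 G} → SameCopy c d → SameCopy (reverse c) (reverse d)
  SameCopy-reverse {c} {d} (p , q) =
    (λ v → (λ z → ∈V-reverse⁻ d (proj₁ (p v) (∈V-reverse c z)))
         , (λ z → ∈V-reverse⁻ c (proj₂ (p v) (∈V-reverse d z)))) ,
    (λ u v → (λ z → ∈A-reverse⁻ d (proj₁ (q v u) (∈A-reverse c z)))
           , (λ z → ∈A-reverse⁻ c (proj₂ (q v u) (∈A-reverse d z))))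

module _ {n : ℕ} {G : Digraph n} where

  ∈A-loopless : {k : ℕ} {H : Digraph k} → (∀ i → ¬ Arc H i i) → (c : Copy H G) → ∀ {u} → ¬ (u , u) ∈A c
  ∈A-loopless loopless c (i , j , a , p , q) with emb-inj c i j (trans p (sym q))
  ... | refl = loopless i a

  ∈A-C7-flip : (c : Copy C7 G) → ∀ {u v} → (u , v) ∈A c → (v , u) ∈A c
  ∈A-C7-flip c (i , j , a , p , q) = j , i , C7-symmetric i j a , q , p

  ∈A-dirC7-antisymmetric : (c : Copy dirC7 G) → ∀ {u v} → (u , v) ∈A c → ¬ (v , u) ∈A c
  ∈A-dirC7-antisymmetric c (i , j , a , p , q) (i' , j' , a' , p' , q')
    rewrite dirC7-arc i j a | dirC7-arc i' j' a'
    with emb-inj c i (suc₇ i') (trans p (sym q'))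
  ... | refl = suc₇-suc₇ i' (emb-inj c _ i' (trans q (sym p')))

  module Edge {H : Digraph 2} (m : Copy H G) where

    x y : Fin n
    x = emb m 0F
    y = emb m 1F

    ∈V-edge : ∀ {v} → v ∈V m → v ≡ x ⊎ v ≡ y
    ∈V-edge (0F , refl) = inj₁ refl
    ∈V-edge (1F , refl) = inj₂ refl

    edge-∈V : ∀ {v} → v ≡ x ⊎ v ≡ y → v ∈V m
    edge-∈V (inj₁ refl) = emb-∈V m 0F
    edge-∈V (inj₂ refl) = emb-∈V m 1F

  module _ (h₀ : Copy C7 G) (m₀ : Copy P2 G) (m₀⊑h₀ : m₀ ⊑ h₀) where
    open Edge m₀

    glue-edge : (F₀ F₁ : Copy C7 G) → SameCopy h₀ F₀ → (x , y) ∈A F₁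
              → (∀ {v} → v ∈V F₀ → v ∈V F₁ → v ≡ x ⊎ v ≡ y)
              → (z : Fin n) → z ∈V F₀ → z ≢ x → z ≢ y
              → (∀ h → (x , y) ∈A h → SameCopy h F₀ ⊎ SameCopy h F₁)
              → Σ (Copy C7 G) λ h₁ → GlueG h₀ h₁ m₀ × (∀ h₂ → GlueG h₀ h₂ m₀ → SameCopy h₂ h₁)
    glue-edge F₀ F₁ h₀~F₀ xy∈F₁ meet z z∈F₀ z≢x z≢y through =
      F₁ , (F₁≁h₀ , vertices , arcs′) , unique
      where
      xy∈m₀ : (x , y) ∈A m₀
      xy∈m₀ = emb-∈A m₀ {0F} {1F} refl
      xy∈h₀ : (x , y) ∈A h₀
      xy∈h₀ = proj₂ m₀⊑h₀ x y xy∈m₀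
      both : ∀ {v} → v ∈V h₀ → v ∈V F₁ → v ≡ x ⊎ v ≡ y
      both p q = meet (∈V-same {c = h₀} {F₀} h₀~F₀ p) q
      F₁≁h₀ : ¬ SameCopy F₁ h₀
      F₁≁h₀ F₁~h₀ with meet z∈F₀ (∈V-same {c = h₀} {F₁} (SameCopy-sym {c = F₁} {h₀} F₁~h₀)
                                  (∈V-same {c = F₀} {h₀} (SameCopy-sym {c = h₀} {F₀} h₀~F₀) z∈F₀))
      ... | inj₁ z≡x = z≢x z≡x
      ... | inj₂ z≡y = z≢y z≡y
      vertices : ∀ v → ((v ∈V h₀) × (v ∈V F₁)) iff (v ∈V m₀)
      vertices v = (λ (p , q) → edge-∈V (both p q))
                 , λ r → case ∈V-edge r of λ where
                           (inj₁ refl) → ∈A-source h₀ xy∈h₀ , ∈A-source F₁ xy∈F₁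
                           (inj₂ refl) → ∈A-target h₀ xy∈h₀ , ∈A-target F₁ xy∈F₁
      arcs′ : ∀ u v → (((u , v) ∈A h₀) × ((u , v) ∈A F₁)) iff ((u , v) ∈A m₀)
      arcs′ u v = common⇒edge , from′
        where
        common⇒edge : ((u , v) ∈A h₀) × ((u , v) ∈A F₁) → (u , v) ∈A m₀
        common⇒edge (p , q)
          with both (∈A-source h₀ p) (∈A-source F₁ q) | both (∈A-target h₀ p) (∈A-target F₁ q)
        ... | inj₁ refl | inj₁ refl = ⊥-elim (∈A-loopless C7-loopless h₀ p)
        ... | inj₁ refl | inj₂ refl = xy∈m₀
        ... | inj₂ refl | inj₁ refl = emb-∈A m₀ {1F} {0F} refl
        ... | inj₂ refl | inj₂ refl = ⊥-elim (∈A-loopless C7-loopless h₀ p)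
        from′ : (u , v) ∈A m₀ → ((u , v) ∈A h₀) × ((u , v) ∈A F₁)
        from′ (0F , 1F , _ , refl , refl) = xy∈h₀ , xy∈F₁
        from′ (1F , 0F , _ , refl , refl) = ∈A-C7-flip h₀ xy∈h₀ , ∈A-C7-flip F₁ xy∈F₁
      unique : ∀ h₂ → GlueG h₀ h₂ m₀ → SameCopy h₂ F₁
      unique h₂ (h₂≁h₀ , _ , arcs₂) with through h₂ (proj₂ (proj₂ (arcs₂ x y) xy∈m₀))
      ... | inj₁ h₂~F₀ =
        ⊥-elim (h₂≁h₀ (SameCopy-trans {c = h₂} {F₀} {h₀} h₂~F₀ (SameCopy-sym {c = h₀} {F₀} h₀~F₀)))
      ... | inj₂ h₂~F₁ = h₂~F₁

  module _ (h₀ : Copy dirC7 G) (m₀ : Copy dirP2 G) (m₀⊑h₀ : m₀ ⊑ h₀) where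
    open Edge m₀

    glue-arc : (C₀ C₁ : Copy dirC7 G) → SameCopy h₀ C₀ → (y , x) ∈A C₁
             → (∀ {v} → v ∈V C₀ → v ∈V C₁ → v ≡ x ⊎ v ≡ y)
             → (∀ h → (y , x) ∈A h → SameCopy h C₁ ⊎ (∃ λ z → z ∈V C₀ × z ∈V h × z ≢ x × z ≢ y))
             → Σ (Copy dirC7 G) λ h₁ → GlueD h₀ h₁ m₀ × (∀ h₂ → GlueD h₀ h₂ m₀ → SameCopy h₂ h₁)
    glue-arc C₀ C₁ h₀~C₀ yx∈C₁ meet through = C₁ , (C₁≁h₀ , vertices , arcs′) , unique
      where
      xy∈m₀ : (x , y) ∈A m₀
      xy∈m₀ = emb-∈A m₀ {0F} {1F} refl
      xy∈h₀ : (x , y) ∈A h₀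
      xy∈h₀ = proj₂ m₀⊑h₀ x y xy∈m₀
      both : ∀ {v} → v ∈V h₀ → v ∈V C₁ → v ≡ x ⊎ v ≡ y
      both p q = meet (∈V-same {c = h₀} {C₀} h₀~C₀ p) q
      C₁≁h₀ : ¬ SameCopy C₁ h₀
      C₁≁h₀ C₁~h₀ = ∈A-dirC7-antisymmetric h₀ xy∈h₀ (∈A-same {c = C₁} {h₀} C₁~h₀ yx∈C₁)
      vertices : ∀ v → ((v ∈V h₀) × (v ∈V C₁)) iff (v ∈V m₀)
      vertices v = (λ (p , q) → edge-∈V (both p q))
                 , λ r → case ∈V-edge r of λ where
                           (inj₁ refl) → ∈A-source h₀ xy∈h₀ , ∈A-target C₁ yx∈C₁
                           (inj₂ refl) → ∈A-target h₀ xy∈h₀ , ∈A-source C₁ yx∈C₁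
      arcs′ : ∀ u v → (((u , v) ∈A h₀) × ((v , u) ∈A C₁)) iff ((u , v) ∈A m₀)
      arcs′ u v = common⇒edge , from′
        where
        common⇒edge : ((u , v) ∈A h₀) × ((v , u) ∈A C₁) → (u , v) ∈A m₀
        common⇒edge (p , q)
          with both (∈A-source h₀ p) (∈A-target C₁ q) | both (∈A-target h₀ p) (∈A-source C₁ q)
        ... | inj₁ refl | inj₁ refl = ⊥-elim (∈A-loopless dirC7-loopless h₀ p)
        ... | inj₁ refl | inj₂ refl = xy∈m₀
        ... | inj₂ refl | inj₁ refl = ⊥-elim (∈A-dirC7-antisymmetric h₀ xy∈h₀ p)
        ... | inj₂ refl | inj₂ refl = ⊥-elim (∈A-loopless dirC7-loopless h₀ p)
        from′ : (u , v) ∈A m₀ → ((u , v) ∈A h₀) × ((v , u) ∈A C₁)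
        from′ (0F , 1F , _ , refl , refl) = xy∈h₀ , yx∈C₁
      unique : ∀ h₂ → GlueD h₀ h₂ m₀ → SameCopy h₂ C₁
      unique h₂ (_ , vertices₂ , arcs₂) with through h₂ (proj₂ (proj₂ (arcs₂ x y) xy∈m₀))
      ... | inj₁ h₂~C₁ = h₂~C₁
      ... | inj₂ (z , z∈C₀ , z∈h₂ , z≢x , z≢y)
        with ∈V-edge (proj₁ (vertices₂ z)
                            (∈V-same {c = C₀} {h₀} (SameCopy-sym {c = h₀} {C₀} h₀~C₀) z∈C₀ , z∈h₂))
      ...   | inj₁ z≡x = ⊥-elim (z≢x z≡x)
      ...   | inj₂ z≡y = ⊥-elim (z≢y z≡y)

module Faces {n : ℕ} {G : Digraph n} (R : Rotation G) (undirected : Undirected G) (trivalent : Trivalent R)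
  (period : ∀ {u v} → Arc G u v → FacePeriod R (u , v))
  (face-cycle : ∀ {u v} → Arc G u v → IsCycle₇ G (faceWalk R (u , v)))
  (left-turning-cycle : ∀ {w} → IsCycle₇ G w → w 2F ≡ next R (w 1F) (w 0F)
                      → ∀ i → w i ≡ faceWalk R (w 0F , w 1F) i)
  where

  face : ∀ {u v} → Arc G u v → Copy C7 G
  face {u} {v} a = cycleCopy undirected (faceWalk R (u , v)) (face-cycle a)

  dirFace : ∀ {u v} → Arc G u v → Copy dirC7 G
  dirFace {u} {v} a = dirCycleCopy (faceWalk R (u , v)) (face-cycle a)

  revFace : ∀ {u v} → Arc G u v → Copy dirC7 G
  revFace a = reverse undirected (dirFace a)

  -- A right turn at w 1F: the reflected walk (w 2F, w 1F, w 0F, w 6F, …) turns left there.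
  right-turning-cycle : ∀ {w} → IsCycle₇ G w → w 2F ≢ next R (w 1F) (w 0F)
                      → ∀ i → w i ≡ faceWalk R (w 2F , w 1F) (reflect₇ i)
  right-turning-cycle {w} w-cycle@(cycle₇ arcs _) not-left i
    with trivalent (undirected (arcs 0F)) (arcs 1F) (isCycle₇-2≢0 w-cycle)
  ... | inj₁ left  = ⊥-elim (not-left left)
  ... | inj₂ right =
    trans (cong w (sym (reflect₇-involutive i)))
          (left-turning-cycle (isCycle₇-reflect undirected w-cycle) left′ (reflect₇ i))
    where
    left′ : w 0F ≡ next R (w 1F) (w 2F)
    left′ = sym (trans (cong (next R (w 1F)) right) (next-prev R (w 1F) (w 0F) (undirected (arcs 0F))))

  cycles-determined-by-2-arcs : CyclesDeterminedBy2Arcs G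
  cycles-determined-by-2-arcs {w} {w'} w-cycle w'-cycle e₀ e₁ e₂ i
    with w 2F ≟ᶠ next R (w 1F) (w 0F)
  ... | yes left = trans (left-turning-cycle w-cycle left i)
                  (trans (cong₂ (λ x y → faceWalk R (x , y) i) e₀ e₁)
                         (sym (left-turning-cycle w'-cycle left′ i)))
    where left′ = trans (sym e₂) (trans left (cong₂ (next R) e₁ e₀))
  ... | no not-left = trans (right-turning-cycle w-cycle not-left i)
                     (trans (cong₂ (λ x y → faceWalk R (x , y) (reflect₇ i)) e₂ e₁)
                            (sym (right-turning-cycle w'-cycle not-left′ i)))
    where not-left′ = λ p → not-left (trans e₂ (trans p (cong₂ (next R) (sym e₁) (sym e₀))))

  copy-face : (c : Copy C7 G) → ∃ λ u → ∃ λ v → Σ (Arc G u v) λ a → SameCopy c (face a)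
  copy-face c with emb c 2F ≟ᶠ next R (emb c 1F) (emb c 0F)
  ... | yes left = _ , _ , a , SameCopy-≗ c (face a) (left-turning-cycle c-cycle left)
    where c-cycle = emb-isCycle₇ C7-suc₇ c ; a = cycle-arc c-cycle 0F
  ... | no not-left =
    _ , _ , a , SameCopy-reindex c (face a) reflect₇ reflect₇-surjective C7-reflect₇-invariant
                  (right-turning-cycle c-cycle not-left)
    where c-cycle = emb-isCycle₇ C7-suc₇ c ; a = undirected (cycle-arc c-cycle 1F)

  dirCopy-face : (c : Copy dirC7 G) → ∃ λ u → ∃ λ v → Σ (Arc G u v) λ a →
                 SameCopy c (dirFace a) ⊎ SameCopy c (revFace a)
  dirCopy-face c with emb c 2F ≟ᶠ next R (emb c 1F) (emb c 0F)
  ... | yes left = _ , _ , a , inj₁ (SameCopy-≗ c (dirFace a) (left-turning-cycle c-cycle left))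
    where c-cycle = emb-isCycle₇ dirC7-suc₇ c ; a = cycle-arc c-cycle 0F
  ... | no not-left = _ , _ , a , inj₂ (SameCopy-≗ c (revFace a)
                                                   (right-turning-cycle c-cycle not-left))
    where c-cycle = emb-isCycle₇ dirC7-suc₇ c ; a = undirected (cycle-arc c-cycle 1F)

  faces-are-7-cycles : FacesAre7Cycles R
  faces-are-7-cycles = (λ u v a → face a , λ _ → refl)
                  , (λ c → let (u , v , a , same) = copy-face c in u , v , a , face a , (λ _ → refl) , same)

  module _ {u v x y} (a : Arc G u v) (b : Arc G x y) (m : ℕ) (e : iter (faceStep R) m (u , v) ≡ (x , y)) where

    face-iter : ∀ i → faceWalk R (x , y) i ≡ faceWalk R (u , v) (iter suc₇ m i)
    face-iter i = trans (cong (λ d → faceWalk R d i) (sym e)) (faceWalk-iter R (period a) m i)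

    SameCopy-face-iter : SameCopy (face a) (face b)
    SameCopy-face-iter = SameCopy-sym {c = face b} {face a}
      (SameCopy-reindex (face b) (face a) (iter suc₇ m) (iter-surjective suc₇-surjective m)
                        (iter-arc-invariant C7-suc₇-invariant m) face-iter)

    SameCopy-dirFace-iter : SameCopy (dirFace a) (dirFace b)
    SameCopy-dirFace-iter = SameCopy-sym {c = dirFace b} {dirFace a}
      (SameCopy-reindex (dirFace b) (dirFace a) (iter suc₇ m) (iter-surjective suc₇-surjective m)
                        (iter-arc-invariant dirC7-suc₇-invariant m) face-iter)

  face-through-arc : ∀ {u v x y} (a : Arc G u v) (b : Arc G x y) → (x , y) ∈A face a
                   → SameCopy (face a) (face b) ⊎ SameCopy (face a) (face (undirected b))
  face-through-arc a b (i , j , ij , p , q) with C7-arc i j ij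
  ... | inj₁ refl =
    inj₁ (SameCopy-face-iter a b (toℕ i) (trans (faceWalk-dart R (period a) i) (cong₂ _,_ p q)))
  ... | inj₂ refl =
    inj₂ (SameCopy-face-iter a (undirected b) (toℕ j) (trans (faceWalk-dart R (period a) j) (cong₂ _,_ q p)))

  dirFace-through-arc : ∀ {u v x y} (a : Arc G u v) (b : Arc G x y) → (x , y) ∈A dirFace a
                      → SameCopy (dirFace a) (dirFace b)
  dirFace-through-arc a b (i , j , ij , p , q) rewrite dirC7-arc i j ij =
    SameCopy-dirFace-iter a b (toℕ i) (trans (faceWalk-dart R (period a) i) (cong₂ _,_ p q))

  cycles-through-edge : ∀ {x y} (b : Arc G x y) (h : Copy C7 G) → (x , y) ∈A h
                      → SameCopy h (face b) ⊎ SameCopy h (face (undirected b))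
  cycles-through-edge b h xy∈h with copy-face h
  ... | _ , _ , a , h~a with face-through-arc a b (∈A-same {c = h} {face a} h~a xy∈h)
  ...   | inj₁ a~b = inj₁ (SameCopy-trans {c = h} {face a} {face b} h~a a~b)
  ...   | inj₂ a~b = inj₂ (SameCopy-trans {c = h} {face a} {face (undirected b)} h~a a~b)

  cycles-through-arc : ∀ {x y} (b : Arc G x y) (h : Copy dirC7 G) → (x , y) ∈A h
                     → SameCopy h (dirFace b) ⊎ SameCopy h (revFace (undirected b))
  cycles-through-arc b h xy∈h with dirCopy-face h
  ... | _ , _ , a , inj₁ h~a =
    inj₁ (SameCopy-trans {c = h} {dirFace a} {dirFace b} h~a
           (dirFace-through-arc a b (∈A-same {c = h} {dirFace a} h~a xy∈h)))
  ... | _ , _ , a , inj₂ h~a =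
    inj₂ (SameCopy-trans {c = h} {revFace a} {revFace (undirected b)} h~a
           (SameCopy-reverse undirected {dirFace a} {dirFace (undirected b)}
             (dirFace-through-arc a (undirected b)
               (∈A-reverse undirected (dirFace a) (∈A-same {c = h} {revFace a} h~a xy∈h)))))

  face-representatives : ∀ {m} (rep : Fin m → Dart n)
    (rep-arc : ∀ k → Arc G (proj₁ (rep k)) (proj₂ (rep k)))
    → (∀ u v → Arc G u v → ∃ λ k → ∃ λ (i : Fin 7) → iter (faceStep R) (toℕ i) (rep k) ≡ (u , v))
    → (∀ k l → k ≢ l → ∃ λ i → ∀ j → faceWalk R (rep l) j ≢ faceWalk R (rep k) i)
    → ExactlyCopies m C7 G
  face-representatives rep rep-arc covers separated = (λ k → face (rep-arc k)) , distinct , complete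
    where
    distinct : ∀ k l → SameCopy (face (rep-arc k)) (face (rep-arc l)) → k ≡ l
    distinct k l same with k ≟ᶠ l
    ... | yes k≡l = k≡l
    ... | no k≢l with separated k l k≢l
    ...   | i , outside with ∈V-same {c = face (rep-arc k)} {face (rep-arc l)} same (i , refl)
    ...     | j , p = ⊥-elim (outside j p)
    complete : ∀ c → ∃ λ k → SameCopy c (face (rep-arc k))
    complete c with copy-face c
    ... | u , v , a , c~a with covers u v a
    ...   | k , i , e =
      k , SameCopy-trans {c = c} {face a} {face (rep-arc k)} c~a
            (SameCopy-sym {c = face (rep-arc k)} {face a} (SameCopy-face-iter (rep-arc k) a (toℕ i) e))

  third-vertex : ∀ {x y} (b : Arc G x y) → faceWalk R (x , y) 2F ≢ x × faceWalk R (x , y) 2F ≢ y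
  third-vertex b = (λ p → case cycle-inj (face-cycle b) 2F 0F p of λ ())
                 , (λ p → case cycle-inj (face-cycle b) 2F 1F p of λ ())

  module _ (adjacent-faces-meet : ∀ x y (b : Arc G x y) v
                       → v ∈V face b → v ∈V face (undirected b) → v ≡ x ⊎ v ≡ y) where

    module _ (h₀ : Copy C7 G) (m₀ : Copy P2 G) (m₀⊑h₀ : m₀ ⊑ h₀) where
      open Edge m₀

      private
        b : Arc G x y
        b = ∈A-arc h₀ (proj₂ m₀⊑h₀ x y (emb-∈A m₀ {0F} {1F} refl))
        b′ = undirected b

      glue-C7 : Σ (Copy C7 G) λ h₁ → GlueG h₀ h₁ m₀ × (∀ h₂ → GlueG h₀ h₂ m₀ → SameCopy h₂ h₁)
      glue-C7 with cycles-through-edge b h₀ (proj₂ m₀⊑h₀ x y (emb-∈A m₀ {0F} {1F} refl))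
      ... | inj₁ h₀~xy =
        glue-edge h₀ m₀ m₀⊑h₀ (face b) (face b′) h₀~xy
          (∈A-C7-flip (face b′) (emb-∈A (face b′) {0F} {1F} (C7-suc₇ 0F)))
          (λ {v} → adjacent-faces-meet x y b v)
          (faceWalk R (x , y) 2F) (2F , refl) (proj₁ (third-vertex b)) (proj₂ (third-vertex b))
          (cycles-through-edge b)
      ... | inj₂ h₀~yx =
        glue-edge h₀ m₀ m₀⊑h₀ (face b′) (face b) h₀~yx
          (emb-∈A (face b) {0F} {1F} (C7-suc₇ 0F)) (λ {v} p q → adjacent-faces-meet x y b v q p)
          (faceWalk R (y , x) 2F) (2F , refl) (proj₂ (third-vertex b′)) (proj₁ (third-vertex b′))
          (λ h xy∈h → swap (cycles-through-edge b h xy∈h))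

    module _ (h₀ : Copy dirC7 G) (m₀ : Copy dirP2 G) (m₀⊑h₀ : m₀ ⊑ h₀) where
      open Edge m₀

      private
        b : Arc G x y
        b = ∈A-arc h₀ (proj₂ m₀⊑h₀ x y (emb-∈A m₀ {0F} {1F} refl))
        b′ = undirected b
        b″ = undirected b′

      glue-dirC7 : Σ (Copy dirC7 G) λ h₁ → GlueD h₀ h₁ m₀ × (∀ h₂ → GlueD h₀ h₂ m₀ → SameCopy h₂ h₁)
      glue-dirC7 with cycles-through-arc b h₀ (proj₂ m₀⊑h₀ x y (emb-∈A m₀ {0F} {1F} refl))
      ... | inj₁ h₀~xy =
        glue-arc h₀ m₀ m₀⊑h₀ (dirFace b) (dirFace b′) h₀~xy
          (emb-∈A (dirFace b′) {0F} {1F} (dirC7-suc₇ 0F)) (λ {v} → adjacent-faces-meet x y b v) through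
        where
        through : ∀ h → (y , x) ∈A h → SameCopy h (dirFace b′)
                ⊎ (∃ λ z → z ∈V dirFace b × z ∈V h × z ≢ x × z ≢ y)
        through h yx∈h with cycles-through-arc b′ h yx∈h
        ... | inj₁ h~yx = inj₁ h~yx
        ... | inj₂ h~rev-xy =
          inj₂ (faceWalk R (x , y) 2F , (2F , refl) ,
                ∈V-same {c = revFace b″} {h} (SameCopy-sym {c = h} {revFace b″} h~rev-xy)
                        (∈V-reverse⁻ undirected (dirFace b″) (2F , refl)) ,
                third-vertex b)
      ... | inj₂ h₀~rev-yx =
        glue-arc h₀ m₀ m₀⊑h₀ (revFace b′) (revFace b″) h₀~rev-yx
          (∈A-reverse⁻ undirected (dirFace b″) (emb-∈A (dirFace b″) {0F} {1F} (dirC7-suc₇ 0F)))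
          (λ {v} p q → adjacent-faces-meet x y b″ v (∈V-reverse undirected (dirFace b″) q)
                                                     (∈V-reverse undirected (dirFace b′) p))
          through
        where
        through : ∀ h → (y , x) ∈A h → SameCopy h (revFace b″)
                ⊎ (∃ λ z → z ∈V revFace b′ × z ∈V h × z ≢ x × z ≢ y)
        through h yx∈h with cycles-through-arc b′ h yx∈h
        ... | inj₂ h~rev-xy = inj₁ h~rev-xy
        ... | inj₁ h~yx =
          inj₂ (faceWalk R (y , x) 2F , ∈V-reverse⁻ undirected (dirFace b′) (2F , refl) ,
                ∈V-same {c = dirFace b′} {h} (SameCopy-sym {c = h} {dirFace b′} h~yx) (2F , refl) ,
                proj₂ (third-vertex b′) , proj₁ (third-vertex b′))

module _ {n : ℕ} {G : Digraph n} (R : Rotation G) where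

  turn : Bool → Fin n → Fin n → Fin n
  turn true  x y = next R y x
  turn false x y = prev R y x

  turnWalk : ∀ {m} → Fin n → Fin n → Vec Bool m → Vec (Fin n) (2 + m)
  turnWalk x y []       = x ∷ y ∷ []
  turnWalk x y (s ∷ ss) = x ∷ turnWalk y (turn s x y) ss

  turnWalk-left : ∀ m x y (i : Fin (2 + m))
                → lookup (turnWalk x y (replicate m true)) i ≡ proj₁ (iter (faceStep R) (toℕ i) (x , y))
  turnWalk-left zero    x y 0F = refl
  turnWalk-left zero    x y 1F = refl
  turnWalk-left (suc m) x y zero    = refl
  turnWalk-left (suc m) x y (suc i) =
    trans (turnWalk-left m y (next R y x) i) (cong proj₁ (iter-shift (faceStep R) (toℕ i) (x , y)))

  NonBacktracking : ∀ {m} → Vec (Fin n) (2 + m) → Set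
  NonBacktracking {zero}  (x ∷ y ∷ [])     = Arc G x y
  NonBacktracking {suc m} (x ∷ y ∷ z ∷ ws) = Arc G x y × z ≢ x × NonBacktracking (y ∷ z ∷ ws)

  turns : ∀ {m} → Vec (Fin n) (2 + m) → Vec Bool m
  turns {zero}  (x ∷ y ∷ [])     = []
  turns {suc m} (x ∷ y ∷ z ∷ ws) = does (z ≟ᶠ next R y x) ∷ turns (y ∷ z ∷ ws)

  module _ (undirected : Undirected G) (trivalent : Trivalent R) where

    first-arc : ∀ {m} (ws : Vec (Fin n) (2 + m)) → NonBacktracking ws → Arc G (head ws) (head (tail ws))
    first-arc {zero}  (x ∷ y ∷ [])     xy = xy
    first-arc {suc m} (x ∷ y ∷ z ∷ ws) (xy , _) = xy

    turn-choice : ∀ {x y z} → Arc G y x → Arc G y z → z ≢ x → turn (does (z ≟ᶠ next R y x)) x y ≡ z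
    turn-choice {x} {y} {z} yx yz z≢x = choose (z ≟ᶠ next R y x)
      where
      choose : (left? : Dec (z ≡ next R y x)) → turn (does left?) x y ≡ z
      choose (yes left) = sym left
      choose (no not-left) with trivalent yx yz z≢x
      ... | inj₁ left  = ⊥-elim (not-left left)
      ... | inj₂ right = sym right

    turnWalk-turns : ∀ {m} (ws : Vec (Fin n) (2 + m)) → NonBacktracking ws
                   → turnWalk (head ws) (head (tail ws)) (turns ws) ≡ ws
    turnWalk-turns {zero}  (x ∷ y ∷ [])     _ = refl
    turnWalk-turns {suc m} (x ∷ y ∷ z ∷ ws) (xy , z≢x , rest)
      rewrite turn-choice (undirected xy) (first-arc (y ∷ z ∷ ws) rest) z≢x =
      cong (x ∷_) (turnWalk-turns (y ∷ z ∷ ws) rest)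

    nonBacktracking-cycle : ∀ {w} → IsCycle₇ G w → NonBacktracking (tabulate w)
    nonBacktracking-cycle (cycle₇ arcs inj) =
      arcs 0F , distinct 2F 0F (λ ()) , arcs 1F , distinct 3F 1F (λ ()) , arcs 2F , distinct 4F 2F (λ ()) ,
      arcs 3F , distinct 5F 3F (λ ()) , arcs 4F , distinct 6F 4F (λ ()) , arcs 5F
      where
      distinct : ∀ i j → i ≢ j → _ ≢ _
      distinct i j i≢j p = i≢j (inj i j p)

    module _ (cycles-turn-left : ∀ u v → Arc G u v → ∀ ss → IsCycle₇ G (lookup (turnWalk u v (true ∷ ss)))
                         → ss ≡ replicate 4 true) where

      left-turns : ∀ u v (ss : Vec Bool 5) → Arc G u v → IsCycle₇ G (lookup (turnWalk u v ss))
                 → head ss ≡ true → ss ≡ replicate 5 true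
      left-turns u v (true ∷ ss) a c refl = cong (true ∷_) (cycles-turn-left u v a ss c)

      left-turning-cycle : ∀ {w} → IsCycle₇ G w → w 2F ≡ next R (w 1F) (w 0F)
                         → ∀ i → w i ≡ faceWalk R (w 0F , w 1F) i
      left-turning-cycle {w} w-cycle left i = begin
        w i
          ≡⟨ as-walk i ⟩
        lookup (turnWalk (w 0F) (w 1F) (turns (tabulate w))) i
          ≡⟨ cong (λ ss → lookup (turnWalk (w 0F) (w 1F) ss) i) all-left ⟩
        lookup (turnWalk (w 0F) (w 1F) (replicate 5 true)) i
          ≡⟨ turnWalk-left 5 (w 0F) (w 1F) i ⟩
        faceWalk R (w 0F , w 1F) i
          ∎
        where
        open ≡-Reasoning
        as-walk : ∀ i → w i ≡ lookup (turnWalk (w 0F) (w 1F) (turns (tabulate w))) i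
        as-walk i =
          trans (sym (lookup∘tabulate w i))
                (cong (λ ws → lookup ws i) (sym (turnWalk-turns (tabulate w) (nonBacktracking-cycle w-cycle))))
        all-left : turns (tabulate w) ≡ replicate 5 true
        all-left = left-turns (w 0F) (w 1F) (turns (tabulate w)) (cycle-arc w-cycle 0F)
                     (isCycle₇-≗ as-walk w-cycle) (dec-true (w 2F ≟ᶠ next R (w 1F) (w 0F)) left)

all-Vec-Bool? : ∀ m {P : Vec Bool m → Set} → (∀ ss → Dec (P ss)) → Dec (∀ ss → P ss)
all-Vec-Bool? zero    P? = map′ (λ p → λ { [] → p }) (λ f → f []) (P? [])
all-Vec-Bool? (suc m) P? =
  map′ (λ (t , f) → λ { (true ∷ ss) → t ss ; (false ∷ ss) → f ss })
       (λ g → (λ ss → g (true ∷ ss)) , (λ ss → g (false ∷ ss)))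
       (all-Vec-Bool? m (λ ss → P? (true ∷ ss)) ×-dec all-Vec-Bool? m (λ ss → P? (false ∷ ss)))

module _ {n : ℕ} (G : Digraph n) where

  arc? : ∀ u v → Dec (Arc G u v)
  arc? u v = arc G u v ≟ᵇ true

  isCycle₇? : ∀ w → Dec (IsCycle₇ G w)
  isCycle₇? w = map′ (λ (a , i) → cycle₇ a i) (λ c → cycle-arc c , cycle-inj c)
    ((all? λ i → arc? (w i) (w (suc₇ i))) ×-dec (all? λ i → all? λ j → (w i ≟ᶠ w j) →-dec (i ≟ᶠ j)))

ExactOrderᶠ : {A : Set} → (A → A) → ℕ → A → Set
ExactOrderᶠ f k x = iter f k x ≡ x × (∀ (j : Fin k) → toℕ j ≢ 0 → iter f (toℕ j) x ≢ x)

exactOrderᶠ? : {A : Set} → DecidableEquality A → ∀ f k x → Dec (ExactOrderᶠ {A} f k x)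
exactOrderᶠ? _≟_ f k x =
  (iter f k x ≟ x) ×-dec (all? λ j → ¬? (toℕ j ≟ℕ 0) →-dec ¬? (iter f (toℕ j) x ≟ x))

exactOrder : {A : Set} (f : A → A) (k : ℕ) (x : A) → ExactOrderᶠ f k x → ExactOrder f k x
exactOrder f k x (period , minimal) = period , λ j 0<j j<k p →
  minimal (fromℕ< j<k) (λ j≡0 → <-irrefl (sym (trans (sym (toℕ-fromℕ< j<k)) j≡0)) 0<j)
          (trans (cong (λ i → iter f i x) (toℕ-fromℕ< j<k)) p)

and-applyUpTo-+ : ∀ (g : ℕ → Bool) k m
                → and (applyUpTo g (k + m)) ≡ and (applyUpTo g k) ∧ and (applyUpTo (λ j → g (k + j)) m)
and-applyUpTo-+ g zero    m = refl
and-applyUpTo-+ g (suc k) m =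
  trans (cong (g 0 ∧_) (and-applyUpTo-+ (λ j → g (suc j)) k m)) (sym (∧-assoc (g 0) _ _))

applyUpTo-cong : ∀ {A : Set} {f g : ℕ → A} → (∀ j → f j ≡ g j) → ∀ m → applyUpTo f m ≡ applyUpTo g m
applyUpTo-cong f≗g zero    = refl
applyUpTo-cong f≗g (suc m) = cong₂ _∷_ (f≗g 0) (applyUpTo-cong (λ j → f≗g (suc j)) m)

and-applyUpTo-periodic : ∀ (g : ℕ → Bool) k → (∀ j → g (k + j) ≡ g j)
                       → ∀ m → and (applyUpTo g (suc m * k)) ≡ and (applyUpTo g k)
and-applyUpTo-periodic g k periodic zero =
  trans (and-applyUpTo-+ g k 0) (∧-identityʳ _)
and-applyUpTo-periodic g k periodic (suc m) = begin
  and (applyUpTo g (k + suc m * k))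
    ≡⟨ and-applyUpTo-+ g k (suc m * k) ⟩
  and (applyUpTo g k) ∧ and (applyUpTo (λ j → g (k + j)) (suc m * k))
    ≡⟨ cong (λ xs → and (applyUpTo g k) ∧ and xs) (applyUpTo-cong periodic (suc m * k)) ⟩
  and (applyUpTo g k) ∧ and (applyUpTo g (suc m * k))
    ≡⟨ cong (and (applyUpTo g k) ∧_) (and-applyUpTo-periodic g k periodic m) ⟩
  and (applyUpTo g k) ∧ and (applyUpTo g k)
    ≡⟨ ∧-idem _ ⟩
  and (applyUpTo g k)
    ∎
  where open ≡-Reasoning

filterᵇ-cong : ∀ {A : Set} {p q : A → Bool} {xs} → All (λ x → p x ≡ q x) xs → filterᵇ p xs ≡ filterᵇ q xs
filterᵇ-cong []                   = refl
filterᵇ-cong {q = q} {x ∷ _} (e ∷ es) rewrite e with q x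
... | true  = cong (x ∷_) (filterᵇ-cong es)
... | false = filterᵇ-cong es

module _ {n : ℕ} {G : Digraph n} (R : Rotation G) where

  -- A face is counted by numFaces at its dart of least code; within one period
  -- of the face traversal every dart of the face has already been met.
  faceMinimum : ℕ → Dart n → Bool
  faceMinimum k d = all (λ j → dartCode d ≤ᵇ dartCode (iter (faceStep R) j d)) (upTo k)

  faceMinimum-period : ∀ {d} → FacePeriod R d → ∀ m → faceMinimum (suc m * 7) d ≡ faceMinimum 7 d
  faceMinimum-period {d} p m =
    trans (cong and (map-upTo g (suc m * 7)))
          (trans (and-applyUpTo-periodic g 7 periodic m) (sym (cong and (map-upTo g 7))))
    where
    g : ℕ → Bool
    g j = dartCode d ≤ᵇ dartCode (iter (faceStep R) j d)
    periodic : ∀ j → (dartCode d ≤ᵇ dartCode (iter (faceStep R) (7 + j) d))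
                   ≡ (dartCode d ≤ᵇ dartCode (iter (faceStep R) j d))
    periodic j = cong (λ e → dartCode d ≤ᵇ dartCode e)
                      (trans (cong (λ k → iter (faceStep R) k d) (+-comm 7 j))
                             (trans (iter-+ (faceStep R) j 7 d) (cong (iter (faceStep R) j) p)))

  numFaces-period : (∀ {u v} → Arc G u v → FacePeriod R (u , v)) → ∀ m → numArcs G ≡ suc m * 7
                  → numFaces R ≡ length (filterᵇ (faceMinimum 7) (darts G))
  numFaces-period period m e =
    cong length (filterᵇ-cong (All.map minimum (all-filter (λ d → T? (arc G (proj₁ d) (proj₂ d)))
                                                           (cartesianProduct (allFin n) (allFin n)))))
    where
    minimum : ∀ {d} → T (arc G (proj₁ d) (proj₂ d)) → faceMinimum (numArcs G) d ≡ faceMinimum 7 d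
    minimum {d} a = trans (cong (λ k → faceMinimum k d) e) (faceMinimum-period (period (Equivalence.to T-≡ a)) m)

  hasGenus-by-count : ∀ f g → numFaces R ≡ f → 2 * n + 2 * f + 4 * g ≡ 4 + numArcs G → HasGenus R g
  hasGenus-by-count f g e euler = subst (λ k → 2 * n + 2 * k + 4 * g ≡ 4 + numArcs G) (sym e) euler


V : Set
V = Fin 56

-- Vertex labels are below 56, so mod only converts them.
vertex : ℕ → V
vertex k = k mod 56

label : V → Fin 3 → ℕ
label u i = fromMaybe 0 (List.head (drop (toℕ i) (lookup kleinNbrs u)))

neighbour : V → Fin 3 → V
neighbour u i = vertex (label u i)

position : V → V → Fin 3
position u v = if toℕ v ≡ᵇ label u 0F then 0F else if toℕ v ≡ᵇ label u 1F then 1F else 2F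

neighbour-arc : ∀ u i → Arc Klein u (neighbour u i)
neighbour-arc = by-decision (all? λ u → all? λ i → arc? Klein u (neighbour u i))

arc-neighbour : ∀ u v → Arc Klein u v → ∃ λ i → neighbour u i ≡ v
arc-neighbour = by-decision (all? λ u → all? λ v → arc? Klein u v →-dec any? λ i → neighbour u i ≟ᶠ v)

position-neighbour : ∀ u i → position u (neighbour u i) ≡ i
position-neighbour = by-decision (all? λ u → all? λ i → position u (neighbour u i) ≟ᶠ i)

module KleinRotation = CubicRotation Klein neighbour position neighbour-arc arc-neighbour position-neighbour

R : Rotation Klein
R = KleinRotation.rotation

trivalent : Trivalent R
trivalent {u} {v} {w} = KleinRotation.trivalent {u} {v} {w}

undirected : Undirected Klein
undirected {u} {v} = by-decision (all? λ u → all? λ v → arc? Klein u v →-dec arc? Klein v u) u v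

_≟ᵈ_ : (d e : Dart 56) → Dec (d ≡ e)
_≟ᵈ_ = ≡-dec _≟ᶠ_ _≟ᶠ_

face-order : ∀ u v → Arc Klein u v → ExactOrderᶠ (faceStep R) 7 (u , v)
face-order = by-decision (all? λ u → all? λ v → arc? Klein u v →-dec
                            exactOrderᶠ? _≟ᵈ_ (faceStep R) 7 (u , v))

vertex-order : ∀ u v → Arc Klein u v → ExactOrderᶠ (next R u) 3 v
vertex-order = by-decision (all? λ u → all? λ v → arc? Klein u v →-dec exactOrderᶠ? _≟ᶠ_ (next R u) 3 v)

petrie-order : ∀ u v → Arc Klein u v → ExactOrderᶠ (petrieStep R) 8 ((u , v) , true)
petrie-order = by-decision (all? λ u → all? λ v → arc? Klein u v →-dec
                            exactOrderᶠ? (≡-dec _≟ᵈ_ _≟ᵇ_) (petrieStep R) 8 ((u , v) , true))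

period : ∀ {u v} → Arc Klein u v → FacePeriod R (u , v)
period {u} {v} a = proj₁ (face-order u v a)

hasType : HasType R 7 3 8
hasType = (λ u v a → exactOrder (faceStep R) 7 (u , v) (face-order u v a))
        , (λ u v a → exactOrder (next R u) 3 v (vertex-order u v a))
        , (λ u v a → exactOrder (petrieStep R) 8 ((u , v) , true) (petrie-order u v a))

face-cycle : ∀ {u v} → Arc Klein u v → IsCycle₇ Klein (faceWalk R (u , v))
face-cycle {u} {v} =
  by-decision (all? λ u → all? λ v → arc? Klein u v →-dec isCycle₇? Klein (faceWalk R (u , v))) u v

cycles-turn-left : ∀ u v → Arc Klein u v → ∀ ss → IsCycle₇ Klein (lookup (turnWalk R u v (true ∷ ss)))
                 → ss ≡ replicate 4 true
cycles-turn-left = by-decision (all? λ u → all? λ v → arc? Klein u v →-dec all-Vec-Bool? 4 λ ss →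
                     isCycle₇? Klein (lookup (turnWalk R u v (true ∷ ss)))
                       →-dec Vec.≡-dec _≟ᵇ_ ss (replicate 4 true))

adjacent-face-walks : ∀ x y → Arc Klein x y
                    → ∀ i j → faceWalk R (x , y) i ≡ faceWalk R (y , x) j → i ≡ 0F ⊎ i ≡ 1F
adjacent-face-walks = by-decision (all? λ x → all? λ y → arc? Klein x y →-dec all? λ i → all? λ j →
                                (faceWalk R (x , y) i ≟ᶠ faceWalk R (y , x) j) →-dec ((i ≟ᶠ 0F) ⊎-dec (i ≟ᶠ 1F)))

Generator : Set
Generator = Fin 2

pattern α = 0F
pattern β = 1F

-- α fixes vertex 0 and rotates its neighbours, β rotates the face of the dart (0, 1); they
-- generate the group PSL(2,7) of rotation-preserving automorphisms.
vertexRotationTable : Vec ℕ 56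
vertexRotationTable =
  0 ∷ 2 ∷ 3 ∷ 1 ∷ 6 ∷ 7 ∷ 8 ∷ 9 ∷ 4 ∷ 5 ∷ 14 ∷ 15 ∷ 16 ∷ 17 ∷
  18 ∷ 19 ∷ 20 ∷ 21 ∷ 10 ∷ 11 ∷ 12 ∷ 13 ∷ 28 ∷ 30 ∷ 29 ∷ 31 ∷ 23 ∷ 32 ∷
  33 ∷ 34 ∷ 26 ∷ 35 ∷ 36 ∷ 22 ∷ 24 ∷ 25 ∷ 27 ∷ 45 ∷ 44 ∷ 47 ∷ 46 ∷ 48 ∷
  39 ∷ 49 ∷ 50 ∷ 51 ∷ 52 ∷ 42 ∷ 53 ∷ 54 ∷ 38 ∷ 37 ∷ 40 ∷ 41 ∷ 43 ∷ 55 ∷ []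

faceRotationTable : Vec ℕ 56
faceRotationTable =
  1 ∷ 4 ∷ 5 ∷ 0 ∷ 10 ∷ 11 ∷ 12 ∷ 13 ∷ 2 ∷ 3 ∷ 21 ∷ 22 ∷ 23 ∷ 24 ∷
  25 ∷ 26 ∷ 27 ∷ 14 ∷ 6 ∷ 7 ∷ 8 ∷ 9 ∷ 36 ∷ 37 ∷ 38 ∷ 39 ∷ 16 ∷ 40 ∷
  41 ∷ 42 ∷ 19 ∷ 43 ∷ 28 ∷ 15 ∷ 17 ∷ 18 ∷ 20 ∷ 54 ∷ 51 ∷ 55 ∷ 53 ∷ 49 ∷
  31 ∷ 48 ∷ 52 ∷ 44 ∷ 50 ∷ 34 ∷ 46 ∷ 45 ∷ 29 ∷ 30 ∷ 32 ∷ 33 ∷ 35 ∷ 47 ∷ []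

reflectionTable : Vec ℕ 56
reflectionTable =
  0 ∷ 1 ∷ 3 ∷ 2 ∷ 5 ∷ 4 ∷ 9 ∷ 8 ∷ 7 ∷ 6 ∷ 13 ∷ 12 ∷ 11 ∷ 10 ∷
  21 ∷ 20 ∷ 19 ∷ 18 ∷ 17 ∷ 16 ∷ 15 ∷ 14 ∷ 27 ∷ 26 ∷ 25 ∷ 24 ∷ 23 ∷ 22 ∷
  36 ∷ 35 ∷ 30 ∷ 34 ∷ 33 ∷ 32 ∷ 31 ∷ 29 ∷ 28 ∷ 37 ∷ 43 ∷ 42 ∷ 41 ∷ 40 ∷
  39 ∷ 38 ∷ 54 ∷ 51 ∷ 53 ∷ 47 ∷ 52 ∷ 50 ∷ 49 ∷ 45 ∷ 48 ∷ 46 ∷ 44 ∷ 55 ∷ []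

words : Vec (Vec (List Generator) 3) 56
words =
  ([] ∷ (α ∷ []) ∷ (α ∷ α ∷ []) ∷ []) ∷
  ((β ∷ []) ∷ (β ∷ α ∷ []) ∷ (β ∷ α ∷ α ∷ []) ∷ []) ∷
  ((α ∷ β ∷ α ∷ α ∷ []) ∷ (α ∷ β ∷ []) ∷ (α ∷ β ∷ α ∷ []) ∷ []) ∷
  ((α ∷ α ∷ β ∷ α ∷ α ∷ []) ∷ (α ∷ α ∷ β ∷ []) ∷ (α ∷ α ∷ β ∷ α ∷ []) ∷ []) ∷
  ((β ∷ β ∷ []) ∷ (β ∷ β ∷ α ∷ []) ∷ (β ∷ β ∷ α ∷ α ∷ []) ∷ []) ∷
  ((β ∷ α ∷ β ∷ α ∷ α ∷ []) ∷ (β ∷ α ∷ β ∷ []) ∷ (β ∷ α ∷ β ∷ α ∷ []) ∷ []) ∷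
  ((α ∷ β ∷ β ∷ []) ∷ (α ∷ β ∷ β ∷ α ∷ []) ∷ (α ∷ β ∷ β ∷ α ∷ α ∷ []) ∷ []) ∷
  ((α ∷ β ∷ α ∷ β ∷ α ∷ α ∷ []) ∷ (α ∷ β ∷ α ∷ β ∷ []) ∷ (α ∷ β ∷ α ∷ β ∷ α ∷ []) ∷ []) ∷
  ((α ∷ α ∷ β ∷ β ∷ α ∷ α ∷ []) ∷ (α ∷ α ∷ β ∷ β ∷ []) ∷ (α ∷ α ∷ β ∷ β ∷ α ∷ []) ∷ []) ∷
  ((β ∷ β ∷ β ∷ β ∷ β ∷ []) ∷ (α ∷ α ∷ β ∷ α ∷ β ∷ []) ∷ (α ∷ α ∷ β ∷ α ∷ β ∷ α ∷ []) ∷ []) ∷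
  ((β ∷ β ∷ β ∷ []) ∷ (β ∷ β ∷ β ∷ α ∷ []) ∷ (β ∷ β ∷ β ∷ α ∷ α ∷ []) ∷ []) ∷
  ((β ∷ β ∷ α ∷ β ∷ α ∷ α ∷ []) ∷ (β ∷ β ∷ α ∷ β ∷ []) ∷ (β ∷ β ∷ α ∷ β ∷ α ∷ []) ∷ []) ∷
  ((β ∷ α ∷ β ∷ β ∷ []) ∷ (β ∷ α ∷ β ∷ β ∷ α ∷ []) ∷ (β ∷ α ∷ β ∷ β ∷ α ∷ α ∷ []) ∷ []) ∷
  ((α ∷ β ∷ β ∷ β ∷ β ∷ []) ∷ (β ∷ α ∷ β ∷ α ∷ β ∷ []) ∷ (β ∷ α ∷ β ∷ α ∷ β ∷ α ∷ []) ∷ []) ∷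
  ((α ∷ β ∷ β ∷ β ∷ []) ∷ (α ∷ β ∷ β ∷ β ∷ α ∷ []) ∷ (α ∷ β ∷ β ∷ β ∷ α ∷ α ∷ []) ∷ []) ∷
  ((α ∷ β ∷ β ∷ α ∷ β ∷ α ∷ []) ∷ (α ∷ β ∷ β ∷ α ∷ β ∷ α ∷ α ∷ []) ∷ (α ∷ β ∷ β ∷ α ∷ β ∷ []) ∷ []) ∷
  ((α ∷ β ∷ α ∷ β ∷ β ∷ []) ∷ (α ∷ β ∷ α ∷ β ∷ β ∷ α ∷ []) ∷ (α ∷ β ∷ α ∷ β ∷ β ∷ α ∷ α ∷ []) ∷ []) ∷
  ((α ∷ α ∷ β ∷ β ∷ β ∷ β ∷ []) ∷ (α ∷ β ∷ α ∷ β ∷ α ∷ β ∷ []) ∷ (α ∷ β ∷ α ∷ β ∷ α ∷ β ∷ α ∷ []) ∷ []) ∷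
  ((α ∷ α ∷ β ∷ β ∷ β ∷ []) ∷ (α ∷ α ∷ β ∷ β ∷ β ∷ α ∷ []) ∷ (α ∷ α ∷ β ∷ β ∷ β ∷ α ∷ α ∷ []) ∷ []) ∷
  ((α ∷ α ∷ β ∷ β ∷ α ∷ β ∷ α ∷ α ∷ []) ∷ (α ∷ α ∷ β ∷ β ∷ α ∷ β ∷ []) ∷ (α ∷ α ∷ β ∷ β ∷ α ∷ β ∷ α ∷ []) ∷ []) ∷
  ((α ∷ α ∷ β ∷ α ∷ β ∷ β ∷ α ∷ α ∷ []) ∷ (α ∷ α ∷ β ∷ α ∷ β ∷ β ∷ []) ∷ (α ∷ α ∷ β ∷ α ∷ β ∷ β ∷ α ∷ []) ∷ []) ∷
  ((β ∷ β ∷ β ∷ β ∷ []) ∷ (β ∷ β ∷ β ∷ β ∷ α ∷ []) ∷ (β ∷ β ∷ β ∷ β ∷ α ∷ α ∷ []) ∷ []) ∷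
  ((β ∷ β ∷ β ∷ α ∷ β ∷ α ∷ α ∷ []) ∷ (β ∷ β ∷ β ∷ α ∷ β ∷ []) ∷ (β ∷ β ∷ β ∷ α ∷ β ∷ α ∷ []) ∷ []) ∷
  ((β ∷ β ∷ α ∷ β ∷ β ∷ []) ∷ (β ∷ β ∷ α ∷ β ∷ β ∷ α ∷ []) ∷ (α ∷ β ∷ α ∷ β ∷ β ∷ α ∷ β ∷ []) ∷ []) ∷
  ((β ∷ α ∷ β ∷ β ∷ β ∷ β ∷ []) ∷ (β ∷ β ∷ α ∷ β ∷ α ∷ β ∷ []) ∷ (β ∷ β ∷ α ∷ β ∷ α ∷ β ∷ α ∷ []) ∷ []) ∷
  ((β ∷ α ∷ β ∷ β ∷ β ∷ []) ∷ (β ∷ α ∷ β ∷ β ∷ β ∷ α ∷ []) ∷ (β ∷ α ∷ β ∷ β ∷ β ∷ α ∷ α ∷ []) ∷ []) ∷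
  ((α ∷ α ∷ β ∷ β ∷ α ∷ β ∷ β ∷ []) ∷ (α ∷ α ∷ β ∷ β ∷ α ∷ β ∷ β ∷ α ∷ []) ∷ (β ∷ α ∷ β ∷ β ∷ α ∷ β ∷ []) ∷ []) ∷
  ((β ∷ α ∷ β ∷ α ∷ β ∷ β ∷ []) ∷ (β ∷ α ∷ β ∷ α ∷ β ∷ β ∷ α ∷ []) ∷ (β ∷ α ∷ β ∷ α ∷ β ∷ β ∷ α ∷ α ∷ []) ∷ []) ∷
  ((α ∷ β ∷ β ∷ β ∷ α ∷ β ∷ α ∷ []) ∷ (α ∷ β ∷ β ∷ β ∷ α ∷ β ∷ α ∷ α ∷ []) ∷ (α ∷ β ∷ β ∷ β ∷ α ∷ β ∷ []) ∷ []) ∷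
  ((α ∷ β ∷ β ∷ α ∷ β ∷ α ∷ β ∷ α ∷ []) ∷ (α ∷ β ∷ α ∷ β ∷ β ∷ β ∷ β ∷ []) ∷ (α ∷ β ∷ β ∷ α ∷ β ∷ α ∷ β ∷ []) ∷ []) ∷
  ((α ∷ β ∷ β ∷ α ∷ β ∷ β ∷ α ∷ []) ∷ (α ∷ α ∷ β ∷ α ∷ β ∷ β ∷ α ∷ β ∷ []) ∷ (α ∷ β ∷ β ∷ α ∷ β ∷ β ∷ []) ∷ []) ∷
  ((α ∷ β ∷ α ∷ β ∷ β ∷ β ∷ α ∷ []) ∷ (α ∷ β ∷ α ∷ β ∷ β ∷ β ∷ α ∷ α ∷ []) ∷ (α ∷ β ∷ α ∷ β ∷ β ∷ β ∷ []) ∷ []) ∷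
  ((α ∷ β ∷ α ∷ β ∷ α ∷ β ∷ β ∷ α ∷ []) ∷ (α ∷ β ∷ α ∷ β ∷ α ∷ β ∷ β ∷ α ∷ α ∷ []) ∷ (α ∷ β ∷ α ∷ β ∷ α ∷ β ∷ β ∷ []) ∷ []) ∷
  ((α ∷ α ∷ β ∷ β ∷ β ∷ α ∷ β ∷ α ∷ []) ∷ (α ∷ α ∷ β ∷ β ∷ β ∷ α ∷ β ∷ α ∷ α ∷ []) ∷ (α ∷ α ∷ β ∷ β ∷ β ∷ α ∷ β ∷ []) ∷ []) ∷
  ((α ∷ α ∷ β ∷ α ∷ β ∷ β ∷ β ∷ β ∷ []) ∷ (α ∷ α ∷ β ∷ β ∷ α ∷ β ∷ α ∷ β ∷ []) ∷ (α ∷ α ∷ β ∷ β ∷ α ∷ β ∷ α ∷ β ∷ α ∷ []) ∷ []) ∷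
  ((α ∷ α ∷ β ∷ α ∷ β ∷ β ∷ β ∷ []) ∷ (α ∷ α ∷ β ∷ α ∷ β ∷ β ∷ β ∷ α ∷ []) ∷ (α ∷ α ∷ β ∷ α ∷ β ∷ β ∷ β ∷ α ∷ α ∷ []) ∷ []) ∷
  ((β ∷ β ∷ β ∷ β ∷ α ∷ β ∷ α ∷ α ∷ []) ∷ (β ∷ β ∷ β ∷ β ∷ α ∷ β ∷ []) ∷ (β ∷ β ∷ β ∷ β ∷ α ∷ β ∷ α ∷ []) ∷ []) ∷
  ((β ∷ β ∷ β ∷ α ∷ β ∷ β ∷ []) ∷ (β ∷ β ∷ β ∷ α ∷ β ∷ β ∷ α ∷ []) ∷ (β ∷ α ∷ β ∷ α ∷ β ∷ β ∷ α ∷ β ∷ []) ∷ []) ∷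
  ((β ∷ β ∷ α ∷ β ∷ β ∷ β ∷ β ∷ []) ∷ (β ∷ β ∷ β ∷ α ∷ β ∷ α ∷ β ∷ []) ∷ (β ∷ β ∷ β ∷ α ∷ β ∷ α ∷ β ∷ α ∷ []) ∷ []) ∷
  ((β ∷ β ∷ α ∷ β ∷ β ∷ β ∷ []) ∷ (β ∷ β ∷ α ∷ β ∷ β ∷ β ∷ α ∷ []) ∷ (β ∷ β ∷ α ∷ β ∷ β ∷ β ∷ α ∷ α ∷ []) ∷ []) ∷
  ((β ∷ β ∷ α ∷ β ∷ α ∷ β ∷ β ∷ []) ∷ (β ∷ β ∷ α ∷ β ∷ α ∷ β ∷ β ∷ α ∷ []) ∷ (β ∷ β ∷ α ∷ β ∷ α ∷ β ∷ β ∷ α ∷ α ∷ []) ∷ []) ∷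
  ((β ∷ α ∷ β ∷ β ∷ β ∷ α ∷ β ∷ α ∷ []) ∷ (β ∷ α ∷ β ∷ β ∷ β ∷ α ∷ β ∷ α ∷ α ∷ []) ∷ (β ∷ α ∷ β ∷ β ∷ β ∷ α ∷ β ∷ []) ∷ []) ∷
  ((α ∷ α ∷ β ∷ β ∷ α ∷ β ∷ β ∷ β ∷ α ∷ []) ∷ (β ∷ α ∷ β ∷ α ∷ β ∷ β ∷ β ∷ β ∷ []) ∷ (α ∷ α ∷ β ∷ β ∷ α ∷ β ∷ β ∷ β ∷ []) ∷ []) ∷
  ((β ∷ α ∷ β ∷ α ∷ β ∷ β ∷ β ∷ α ∷ []) ∷ (β ∷ α ∷ β ∷ α ∷ β ∷ β ∷ β ∷ α ∷ α ∷ []) ∷ (β ∷ α ∷ β ∷ α ∷ β ∷ β ∷ β ∷ []) ∷ []) ∷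
  ((α ∷ β ∷ β ∷ β ∷ α ∷ β ∷ α ∷ β ∷ []) ∷ (β ∷ α ∷ β ∷ β ∷ β ∷ α ∷ β ∷ β ∷ []) ∷ (α ∷ β ∷ β ∷ α ∷ β ∷ β ∷ β ∷ β ∷ []) ∷ []) ∷
  ((α ∷ β ∷ α ∷ β ∷ α ∷ β ∷ β ∷ α ∷ β ∷ []) ∷ (α ∷ β ∷ β ∷ β ∷ α ∷ β ∷ β ∷ []) ∷ (α ∷ β ∷ β ∷ β ∷ α ∷ β ∷ β ∷ α ∷ []) ∷ []) ∷
  ((β ∷ α ∷ β ∷ α ∷ β ∷ β ∷ β ∷ α ∷ β ∷ []) ∷ (α ∷ β ∷ β ∷ α ∷ β ∷ α ∷ β ∷ β ∷ []) ∷ (α ∷ β ∷ β ∷ α ∷ β ∷ α ∷ β ∷ β ∷ α ∷ []) ∷ []) ∷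
  ((β ∷ β ∷ β ∷ β ∷ α ∷ β ∷ β ∷ β ∷ []) ∷ (α ∷ β ∷ β ∷ α ∷ β ∷ β ∷ β ∷ []) ∷ (α ∷ β ∷ β ∷ α ∷ β ∷ β ∷ β ∷ α ∷ []) ∷ []) ∷
  ((α ∷ β ∷ α ∷ β ∷ β ∷ β ∷ α ∷ β ∷ []) ∷ (α ∷ β ∷ α ∷ β ∷ β ∷ β ∷ α ∷ β ∷ α ∷ []) ∷ (β ∷ β ∷ α ∷ β ∷ α ∷ β ∷ β ∷ β ∷ []) ∷ []) ∷
  ((β ∷ β ∷ α ∷ β ∷ β ∷ β ∷ α ∷ β ∷ α ∷ []) ∷ (α ∷ β ∷ α ∷ β ∷ α ∷ β ∷ β ∷ β ∷ []) ∷ (β ∷ β ∷ α ∷ β ∷ β ∷ β ∷ α ∷ β ∷ []) ∷ []) ∷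
  ((α ∷ β ∷ α ∷ β ∷ β ∷ β ∷ α ∷ β ∷ β ∷ []) ∷ (α ∷ α ∷ β ∷ β ∷ α ∷ β ∷ β ∷ β ∷ β ∷ []) ∷ (α ∷ α ∷ β ∷ β ∷ β ∷ α ∷ β ∷ α ∷ β ∷ []) ∷ []) ∷
  ((β ∷ β ∷ β ∷ α ∷ β ∷ β ∷ β ∷ β ∷ []) ∷ (β ∷ β ∷ β ∷ β ∷ α ∷ β ∷ α ∷ β ∷ []) ∷ (α ∷ α ∷ β ∷ β ∷ β ∷ α ∷ β ∷ β ∷ []) ∷ []) ∷
  ((β ∷ α ∷ β ∷ β ∷ β ∷ α ∷ β ∷ α ∷ β ∷ []) ∷ (β ∷ β ∷ α ∷ β ∷ β ∷ β ∷ α ∷ β ∷ β ∷ []) ∷ (α ∷ α ∷ β ∷ β ∷ α ∷ β ∷ α ∷ β ∷ β ∷ []) ∷ []) ∷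
  ((β ∷ β ∷ β ∷ α ∷ β ∷ α ∷ β ∷ β ∷ []) ∷ (α ∷ β ∷ β ∷ α ∷ β ∷ α ∷ β ∷ β ∷ β ∷ []) ∷ (α ∷ α ∷ β ∷ α ∷ β ∷ β ∷ β ∷ α ∷ β ∷ []) ∷ []) ∷
  ((β ∷ β ∷ β ∷ β ∷ α ∷ β ∷ β ∷ []) ∷ (β ∷ β ∷ β ∷ β ∷ α ∷ β ∷ β ∷ α ∷ []) ∷ (β ∷ β ∷ α ∷ β ∷ α ∷ β ∷ β ∷ α ∷ β ∷ []) ∷ []) ∷
  ((β ∷ β ∷ β ∷ α ∷ β ∷ β ∷ β ∷ []) ∷ (β ∷ β ∷ β ∷ α ∷ β ∷ β ∷ β ∷ α ∷ []) ∷ (α ∷ β ∷ β ∷ β ∷ α ∷ β ∷ β ∷ β ∷ []) ∷ []) ∷ []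

faceRepresentatives : Vec (ℕ × ℕ) 24
faceRepresentatives =
  (0 , 1) ∷ (0 , 2) ∷ (0 , 3) ∷ (1 , 5) ∷ (2 , 7) ∷ (3 , 9) ∷ (4 , 11) ∷ (5 , 13) ∷
  (6 , 15) ∷ (7 , 17) ∷ (8 , 19) ∷ (9 , 21) ∷ (10 , 22) ∷ (11 , 24) ∷ (12 , 26) ∷ (13 , 14) ∷
  (15 , 29) ∷ (17 , 18) ∷ (22 , 38) ∷ (24 , 25) ∷ (28 , 44) ∷ (29 , 31) ∷ (33 , 50) ∷ (34 , 35) ∷ []

permutation : Vec ℕ 56 → V → V
permutation table v = vertex (lookup table v)

generatorTable : Generator → Vec ℕ 56
generatorTable α = vertexRotationTable
generatorTable β = faceRotationTable

-- One less than the order of the generator.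
generatorOrder : Generator → ℕ
generatorOrder α = 2
generatorOrder β = 6

generatorPermutation : Generator → V → V
generatorPermutation g = permutation (generatorTable g)

generator-order : ∀ g v → iter (generatorPermutation g) (suc (generatorOrder g)) v ≡ v
generator-order =
  by-decision (all? λ g → all? λ v → iter (generatorPermutation g) (suc (generatorOrder g)) v ≟ᶠ v)

generator-arc : ∀ g u v → Arc Klein u v → Arc Klein (generatorPermutation g u) (generatorPermutation g v)
generator-arc = by-decision (all? λ g → all? λ u → all? λ v →
                             arc? Klein u v →-dec arc? Klein (generatorPermutation g u) (generatorPermutation g v))

generator : Generator → Aut Klein
generator g =
  aut-of-order (generatorPermutation g) (generatorOrder g) (generator-order g) (λ {u} {v} → generator-arc g u v)

generator-preserves : ∀ g → PreservesRot R (generator g)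
generator-preserves = by-decision (all? λ g → all? λ u → all? λ v → arc? Klein u v →-dec
                                  (next R (generatorPermutation g u) (generatorPermutation g v)
                                     ≟ᶠ generatorPermutation g (next R u v)))

reflectionPermutation : V → V
reflectionPermutation = permutation reflectionTable

reflection : Aut Klein
reflection = aut-of-order reflectionPermutation 1 involution (λ {u} {v} → reflection-arc u v)
  where
  involution : ∀ v → iter reflectionPermutation 2 v ≡ v
  involution = by-decision (all? λ v → iter reflectionPermutation 2 v ≟ᶠ v)
  reflection-arc : ∀ u v → Arc Klein u v → Arc Klein (reflectionPermutation u) (reflectionPermutation v)
  reflection-arc = by-decision (all? λ u → all? λ v → arc? Klein u v →-dec
                                arc? Klein (reflectionPermutation u) (reflectionPermutation v))

reflection-reverses : ReversesRot R reflection
reflection-reverses = by-decision (all? λ u → all? λ v → arc? Klein u v →-dec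
                                  (next R (reflectionPermutation u) (reflectionPermutation (next R u v))
                                     ≟ᶠ reflectionPermutation v))

wordAut : List Generator → Aut Klein
wordAut []       = aut-id
wordAut (g ∷ gs) = aut-∘ (generator g) (wordAut gs)

wordAut-preserves : ∀ gs → PreservesRot R (wordAut gs)
wordAut-preserves []       = preserves-id R
wordAut-preserves (g ∷ gs) =
  preserves-∘ R (generator g) (wordAut gs) (generator-preserves g) (wordAut-preserves gs)

dartAut : V → Fin 3 → Aut Klein
dartAut u i = wordAut (lookup (lookup words u) i)

dartAut-base : ∀ u i → to (dartAut u i) 0F ≡ u × to (dartAut u i) 1F ≡ neighbour u i
dartAut-base =
  by-decision (all? λ u → all? λ i → (to (dartAut u i) 0F ≟ᶠ u) ×-dec (to (dartAut u i) 1F ≟ᶠ neighbour u i))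

base-to-arc : ∀ {u v} → Arc Klein u v
            → Σ (Aut Klein) λ σ → PreservesRot R σ × to σ 0F ≡ u × to σ 1F ≡ v
base-to-arc {u} {v} a =
  let (i , e) = arc-neighbour u v a
  in dartAut u i , wordAut-preserves (lookup (lookup words u) i) , proj₁ (dartAut-base u i)
   , trans (proj₂ (dartAut-base u i)) e

regular : Regular R
regular = regular-from-base R 0F 1F base-to-arc reflection reflection-reverses refl refl

representative : Fin 24 → Dart 56
representative k = let (u , v) = lookup faceRepresentatives k in vertex u , vertex v

representative-arc : ∀ k → Arc Klein (proj₁ (representative k)) (proj₂ (representative k))
representative-arc = by-decision (all? λ k → arc? Klein (proj₁ (representative k)) (proj₂ (representative k)))

representatives-cover : ∀ u v → Arc Klein u v
                      → ∃ λ k → ∃ λ (i : Fin 7) → iter (faceStep R) (toℕ i) (representative k) ≡ (u , v)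
representatives-cover = by-decision (all? λ u → all? λ v → arc? Klein u v →-dec any? λ k → any? λ i →
                                       iter (faceStep R) (toℕ i) (representative k) ≟ᵈ (u , v))

representatives-separated : ∀ k l → k ≢ l
                          → ∃ λ i → ∀ j → faceWalk R (representative l) j ≢ faceWalk R (representative k) i
representatives-separated = by-decision (all? λ k → all? λ l → ¬? (k ≟ᶠ l) →-dec any? λ i → all? λ j →
                                         ¬? (faceWalk R (representative l) j ≟ᶠ faceWalk R (representative k) i))

hasGenus : HasGenus R 3
hasGenus =
  hasGenus-by-count R 24 3 (trans (numFaces-period R (λ {u} {v} → period {u} {v}) 23 refl) face-count) refl
  where
  face-count : length (filterᵇ (faceMinimum R 7) (darts Klein)) ≡ 24
  face-count = refl

-- The vertices of an arc are passed explicitly: they cannot be inferred from the type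
-- Arc Klein u v, which computes.
open Faces R (λ {u} {v} → undirected {u} {v}) (λ {u} {v} {w} → trivalent {u} {v} {w})
  (λ {u} {v} → period {u} {v}) (λ {u} {v} → face-cycle {u} {v})
  (λ {w} → left-turning-cycle R (λ {u} {v} → undirected {u} {v}) (λ {u} {v} {w} → trivalent {u} {v} {w})
                              cycles-turn-left {w})

adjacent-faces-meet : ∀ x y (b : Arc Klein x y) v
                    → v ∈V face {x} {y} b → v ∈V face {y} {x} (undirected {x} {y} b) → v ≡ x ⊎ v ≡ y
adjacent-faces-meet x y b v (i , p) (j , q) =
  Sum.map (λ i≡0 → trans (sym p) (cong (faceWalk R (x , y)) i≡0))
          (λ i≡1 → trans (sym p) (cong (faceWalk R (x , y)) i≡1))
          (adjacent-face-walks x y b i j (trans p (sym q)))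

theorem3 : HM-UH C7 P2 Klein
         × DiHM-UH dirC7 dirP2 Klein
         × ExactlyCopies 24 C7 Klein
         × (Σ (Rotation Klein) λ R → FacesAre7Cycles R × IsKleinMap R)
theorem3 =
    ( (λ c d _ _ → extends-2 arc-transitive refl c d)
    , (λ c d _ _ → extends-7 two-arc-transitive cycles-determined-by-2-arcs C7-suc₇ c d)
    , glue-C7 adjacent-faces-meet )
  , ( (λ c d → extends-2 arc-transitive refl c d)
    , (λ c d → extends-7 two-arc-transitive cycles-determined-by-2-arcs dirC7-suc₇ c d)
    , glue-dirC7 adjacent-faces-meet )
  , face-representatives representative representative-arc representatives-cover representatives-separated
  , (R , faces-are-7-cycles , regular , hasType , hasGenus)
  where
  arc-transitive : ArcTransitive Klein
  arc-transitive = regular⇒arcTransitive R regular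
  two-arc-transitive : TwoArcTransitive Klein
  two-arc-transitive = regular⇒twoArcTransitive R (λ {u} {v} → undirected {u} {v})
                                                  (λ {u} {v} {w} → trivalent {u} {v} {w}) regular
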